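{- Let $p$ and $q$ be prime numbers with $q=p+2$, let $\sigma\in\{+1,-1\}$, and let $C$ be the curve $y^2=2x^4-2\sigma(p+q)x^2+2$. Then: (1) If $p\equiv7\pmod 8$, then $C(\mathbf{Q}_2)\neq\emptyset$. (2) $C(\mathbf{Q}_p)\neq\emptyset$ if and only if $(2/p)=1$, i.e. $p\equiv1,7\pmod 8$. (3) $C(\mathbf{Q}_q)\neq\emptyset$ if and only if $(2/q)=1$, i.e. $q\equiv1,7\pmod 8$ (equivalently $p\equiv5,7\pmod 8$).
   Context: $C(\mathbf{Q}_v)$ denotes the set of points $(x,y)\in\mathbf{Q}_v^2$ satisfying the equation, where $\mathbf{Q}_v$ is the completion of $\mathbf{Q}$ at $v$; $(\cdot/\cdot)$ is the Legendre symbol. -}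

module Defs where

open import Data.Nat as ℕ using (ℕ; suc)
open import Data.Integer using (ℤ; +_; _+_; _*_; _-_; _^_; -_)
open import Data.Integer.Divisibility using (_∣_)
open import Data.Product using (Σ; ∃; _×_)

-- The v-adic integers ℤ_v as the inverse limit of ℤ/v^k:
-- a sequence of integers (x_k) with x_{k+1} ≡ x_k (mod v^k);
-- x_k is the residue of the v-adic integer modulo v^k.
record Zp (v : ℕ) : Set where
  field
    digit : ℕ → ℤ
    coh   : ∀ k → (+ (v ℕ.^ k)) ∣ (digit (suc k) - digit k)
open Zp public

-- C_c : y^2 = 2x^4 - 2c x^2 + 2.
-- A point of C_c over ℚ_v = ℤ_v[1/v]: x = a / v^m, y = b / v^n with a, b ∈ ℤ_v.
-- After multiplying by the unit v^(2n+4m) of ℚ_v the equation reads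
--   b^2 v^(4m) = v^(2n) (2 a^4 - 2 c a^2 v^(2m) + 2 v^(4m))   in ℤ_v,
-- i.e. the two sides agree modulo v^k for every k.
HasQvPoint : (v : ℕ) → (c : ℤ) → Set
HasQvPoint v c =
  Σ ℕ λ m → Σ ℕ λ n → Σ (Zp v) λ a → Σ (Zp v) λ b →
    ∀ k → let V = + v ; A = digit a k ; B = digit b k in
      (+ (v ℕ.^ k)) ∣
        ((B ^ 2) * (V ^ (4 ℕ.* m))
          - (V ^ (2 ℕ.* n)) * ((+ 2) * (A ^ 4) - (+ 2) * c * (A ^ 2) * (V ^ (2 ℕ.* m)) + (+ 2) * (V ^ (4 ℕ.* m))))

-- Legendre symbol (2/p) = 1 for an odd prime p: 2 is a quadratic residue mod p
-- (p ∤ 2 automatically for odd p).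
LegendreTwoIsOne : ℕ → Set
LegendreTwoIsOne p = ∃ λ (x : ℤ) → (+ p) ∣ ((x ^ 2) - (+ 2))

-- Write f x = 2x⁴ - 2cx² + 2 with c = σ(p + q).
-- (1) If p ≡ 7 (mod 8) then 16 ∣ c, so f 1 = 4(1 - 8r) is a 2-adic square (Newton's iteration) and x = 1 gives a point.
-- (2), (3) Let ℓ ∈ {p, q}. As f ℓ ≡ 2 (mod ℓ), if 2 is a square modulo ℓ then Hensel's lemma makes f ℓ a square and
-- x = 1/ℓ gives a point. Conversely, c ≡ 2τ (mod 2ℓ) with τ = ±1, so at x = A/ℓᵐ the homogenised quartic is either an
-- even power of ℓ times a unit ≡ 2s² (mod ℓ), or has odd valuation 4m + 1; as y² has even valuation only the first
-- case occurs, and comparing unit parts shows that 2 is a square modulo ℓ.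
-- The second supplement (2/ℓ) = 1 ⇔ ℓ ≡ ±1 (mod 8) is Fermat's descent on x² - 2 = mℓ in one direction; in the other,
-- if 2 were a non-square then pairing a with 2/a would give (ℓ - 1)! ≡ 2^h, against Wilson's theorem and Gauss's
-- count 2^h h! ≡ h! (mod ℓ), where ℓ = 2h + 1.

module Submission where

open import Data.Empty using (⊥; ⊥-elim)
open import Data.Integer as ℤ using (ℤ; +_; -[1+_]; 0ℤ; 1ℤ; _+_; _-_; _*_; -_; _^_)
import Data.Integer.Properties as ℤₚ
open import Data.Integer.DivMod using (a≡a%ℕn+[a/ℕn]*n; n%ℕd<d)
open import Data.Integer.Divisibility.Signed
open import Data.Integer.Tactic.RingSolver using (solve-∀)
open import Data.List using (List; []; _∷_; length; filter; applyDownFrom; upTo)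
open import Data.List.Membership.Propositional using (_∈_; lose)
open import Data.List.Membership.Propositional.Properties
  using (∈-filter⁺; ∈-filter⁻; ∈-applyDownFrom⁺; ∈-applyDownFrom⁻; ∈-upTo⁺)
open import Data.List.Properties using (filter-accept; filter-reject; filter-all; length-applyDownFrom)
open import Data.List.Relation.Unary.All as All using (All; all?; []; _∷_)
open import Data.List.Relation.Unary.AllPairs using ([]; _∷_)
open import Data.List.Relation.Unary.Any using (here; there; any?; satisfied)
open import Data.List.Relation.Unary.Unique.Propositional using (Unique)
import Data.List.Relation.Unary.Unique.Propositional.Properties as Unique
open import Data.Nat as ℕ using (ℕ; zero; suc; z≤n; s≤s; _≤_; _<_)
open import Data.Nat.Coprimality using (Coprime; coprime-Bézout)
open import Data.Nat.DivMod
  using (m≡m%n+[m/n]*n; m%n<n; m%n%n≡m%n; %-distribˡ-+; %-distribˡ-*; m∣n⇒o%n%m≡o%m)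
import Data.Nat.Divisibility as ℕᵈ
open import Data.Nat.GCD using (module Bézout)
open import Data.Nat.Induction using (<-rec)
open import Data.Nat.Primality
  using (Prime; euclidsLemma; prime⇒irreducible; prime⇒nonZero; prime⇒nonTrivial; composite[4]; composite⇒¬prime)
import Data.Nat.Properties as ℕₚ
import Data.Nat.Tactic.RingSolver as ℕ-Solver
open import Data.Product using (Σ; ∃; _×_; _,_; proj₁; proj₂; map₁; map₂)
open import Data.Sum as Sum using (_⊎_; inj₁; inj₂; [_,_]′)
open import Function using (_∘_; id)
open import Function.Bundles using (_⇔_; mk⇔; Equivalence)
open import Relation.Binary.Definitions using (tri<; tri≈; tri>)
open import Relation.Binary.PropositionalEquality
open import Relation.Nullary using (¬_; Dec; yes; no; ¬?)
open import Relation.Nullary.Decidable using (_×-dec_; _⊎-dec_; _→-dec_; toWitness)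

open import Defs

∣-respʳ-≡ : ∀ {k m n} → m ≡ n → k ∣ m → k ∣ n
∣-respʳ-≡ refl k∣m = k∣m

∣-respˡ-≡ : ∀ {k l n} → k ≡ l → k ∣ n → l ∣ n
∣-respˡ-≡ refl k∣n = k∣n

∣x-x : ∀ k x → k ∣ x - x
∣x-x k x = ∣-respʳ-≡ (sym (ℤₚ.+-inverseʳ x)) (divides 0ℤ refl)

*-mono-∣ : ∀ {a b x y} → a ∣ x → b ∣ y → a * b ∣ x * y
*-mono-∣ {a} {b} (divides q refl) (divides r refl) = divides (q * r) (rearrange q a r b)
  where
  rearrange : ∀ q a r b → q * a * (r * b) ≡ q * r * (a * b)
  rearrange = solve-∀

pos-^ : ∀ v k → + (v ℕ.^ k) ≡ (+ v) ^ k
pos-^ v zero    = refl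
pos-^ v (suc k) = trans (ℤₚ.pos-* v (v ℕ.^ k)) (cong (+ v *_) (pos-^ v k))

x^2≡x*x : ∀ x → x ^ 2 ≡ x * x
x^2≡x*x x = cong (x *_) (ℤₚ.*-identityʳ x)

x^4≡x*x*x*x : ∀ x → x ^ 4 ≡ x * x * x * x
x^4≡x*x*x*x x = trans (cong (λ y → x * (x * (x * y))) (ℤₚ.*-identityʳ x)) (reassociate x)
  where
  reassociate : ∀ x → x * (x * (x * x)) ≡ x * x * x * x
  reassociate = solve-∀

∣-flip : ∀ {k} a b → k ∣ a - b → k ∣ b - a
∣-flip a b k∣a-b = ∣-respʳ-≡ (negate a b) (∣m⇒∣-m k∣a-b)
  where
  negate : ∀ a b → - (a - b) ≡ b - a
  negate = solve-∀

pos-∸ : ∀ {b c} → c ≤ b → + b - + c ≡ + (b ℕ.∸ c)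
pos-∸ {b} {c} c≤b = trans (ℤₚ.[+m]-[+n]≡m⊖n b c) (ℤₚ.⊖-≥ c≤b)

∤-pos-< : ∀ {p n} → 0 < n → n < p → ¬ (+ p ∣ + n)
∤-pos-< {n = suc _} _ n<p p∣n = ℕᵈ.>⇒∤ n<p (∣⇒∣ᵤ p∣n)

private
  ≡-mod-≤⇒≡ : ∀ {p b c} → c ≤ b → b < p → + p ∣ + b - + c → b ≡ c
  ≡-mod-≤⇒≡ {p} {b} {c} c≤b b<p p∣b-c with b ℕ.∸ c in b∸c≡d
  ... | zero  = ℕₚ.≤-antisym (ℕₚ.m∸n≡0⇒m≤n b∸c≡d) c≤b
  ... | suc d = ⊥-elim (∤-pos-< (s≤s z≤n) d<p (∣-respʳ-≡ b-c≡d p∣b-c))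
    where
    d<p : suc d < p
    d<p = ℕₚ.≤-<-trans (subst (ℕ._≤ b) b∸c≡d (ℕₚ.m∸n≤m b c)) b<p
    b-c≡d : + b - + c ≡ + suc d
    b-c≡d = trans (pos-∸ c≤b) (cong +_ b∸c≡d)

≡-mod⇒≡ : ∀ {p b c} → b < p → c < p → + p ∣ + b - + c → b ≡ c
≡-mod⇒≡ {b = b} {c} b<p c<p p∣b-c with ℕₚ.≤-total c b
... | inj₁ c≤b = ≡-mod-≤⇒≡ c≤b b<p p∣b-c
... | inj₂ b≤c = sym (≡-mod-≤⇒≡ b≤c c<p (∣-flip (+ b) (+ c) p∣b-c))

module _ {p : ℕ} (p-prime : Prime p) where

  euclidsLemma-ℤ : ∀ a b → + p ∣ a * b → + p ∣ a ⊎ + p ∣ b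
  euclidsLemma-ℤ a b p∣ab =
    Sum.map ∣ᵤ⇒∣ ∣ᵤ⇒∣ (euclidsLemma ℤ.∣ a ∣ ℤ.∣ b ∣ p-prime (subst (p ℕᵈ.∣_) (ℤₚ.abs-* a b) (∣⇒∣ᵤ p∣ab)))

  ∤-* : ∀ {a b} → ¬ (+ p ∣ a) → ¬ (+ p ∣ b) → ¬ (+ p ∣ a * b)
  ∤-* {a} {b} p∤a p∤b = [ p∤a , p∤b ]′ ∘ euclidsLemma-ℤ a b

  private
    coprime-∤ : ∀ {n} → ¬ (p ℕᵈ.∣ n) → Coprime p n
    coprime-∤ p∤n (d∣p , d∣n) with prime⇒irreducible p-prime d∣p
    ... | inj₁ d≡1  = d≡1
    ... | inj₂ refl = ⊥-elim (p∤n d∣n)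

    pos-Bézout : ∀ a b c d e → a ℕ.+ b ℕ.* c ≡ d ℕ.* e → + a + + b * + c ≡ + d * + e
    pos-Bézout a b c d e eq = begin
      + a + + b * + c     ≡⟨ cong (λ z → + a + z) (sym (ℤₚ.pos-* b c)) ⟩
      + a + + (b ℕ.* c)   ≡⟨ sym (ℤₚ.pos-+ a (b ℕ.* c)) ⟩
      + (a ℕ.+ b ℕ.* c)   ≡⟨ cong +_ eq ⟩
      + (d ℕ.* e)         ≡⟨ ℤₚ.pos-* d e ⟩
      + d * + e           ∎
      where open ≡-Reasoning

    inverse-ℕ : ∀ n → ¬ (+ p ∣ + n) → ∃ λ w → + p ∣ + n * w - 1ℤ
    inverse-ℕ n p∤n with coprime-Bézout (coprime-∤ {n} (λ p∣n → p∤n (∣ᵤ⇒∣ p∣n)))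
    ... | Bézout.+- x y eq = - + y , divides (- + x) (begin
      + n * - + y - 1ℤ      ≡⟨ negate (+ n) (+ y) ⟩
      - (1ℤ + + y * + n)    ≡⟨ cong -_ (pos-Bézout 1 y n x p eq) ⟩
      - (+ x * + p)         ≡⟨ ℤₚ.neg-distribˡ-* (+ x) (+ p) ⟩
      - + x * + p           ∎)
      where
      open ≡-Reasoning
      negate : ∀ n y → n * - y - 1ℤ ≡ - (1ℤ + y * n)
      negate = solve-∀
    ... | Bézout.-+ x y eq = + y , divides (+ x) (begin
      + n * + y - 1ℤ        ≡⟨ cong (_- 1ℤ) (ℤₚ.*-comm (+ n) (+ y)) ⟩
      + y * + n - 1ℤ        ≡⟨ cong (_- 1ℤ) (sym (pos-Bézout 1 x p y n eq)) ⟩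
      1ℤ + + x * + p - 1ℤ   ≡⟨ cancel (+ x * + p) ⟩
      + x * + p             ∎)
      where
      open ≡-Reasoning
      cancel : ∀ z → 1ℤ + z - 1ℤ ≡ z
      cancel = solve-∀

  inverse : ∀ a → ¬ (+ p ∣ a) → ∃ λ w → + p ∣ a * w - 1ℤ
  inverse (+ n)    p∤a = inverse-ℕ n p∤a
  inverse -[1+ n ] p∤a with inverse-ℕ (suc n) (λ p∣n → p∤a (∣m⇒∣-m p∣n))
  ... | w , p∣nw-1 = - w , ∣-respʳ-≡ (cong (_- 1ℤ) (negate (+ suc n) w)) p∣nw-1
    where
    negate : ∀ a w → a * w ≡ - a * - w
    negate = solve-∀

TwoIsSquareMod : ℕ → Set
TwoIsSquareMod n = ∃ λ x → + n ∣ x * x - + 2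

-- Square roots in ℤ_v

mkZp : ∀ v (x : ℕ → ℤ) → (∀ k → (+ v) ^ k ∣ x (suc k) - x k) → Zp v
mkZp v x coherent = record
  { digit = x
  ; coh   = λ k → ∣⇒∣ᵤ (∣-respˡ-≡ (sym (pos-^ v k)) (coherent k))
  }

constZp : ∀ v → ℤ → Zp v
constZp v z = mkZp v (λ _ → z) (λ k → ∣x-x ((+ v) ^ k) z)

IsAdicSquare : ℕ → ℤ → Set
IsAdicSquare v u = Σ (Zp v) λ b → ∀ k → (+ v) ^ k ∣ digit b k * digit b k - u

module NewtonSqrt (L u x₀ w : ℤ)
                  (x₀²≡u : L ∣ x₀ * x₀ - u) (2x₀w≡1 : L ∣ (+ 2) * x₀ * w - 1ℤ) where

  approx : ℕ → ℤ
  approx zero    = x₀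
  approx (suc k) = approx k - (approx k * approx k - u) * w

  private
    step-error : ∀ x u w → let d = x * x - u in
      (x - d * w) * (x - d * w) - u ≡ d * (1ℤ - (+ 2) * x * w) + d * d * (w * w)
    step-error = solve-∀

    derivative : ∀ x x₀ w →
      1ℤ - (+ 2) * x * w ≡ ((+ 2) * x₀ * w - 1ℤ) * - 1ℤ + (x - x₀) * (- (+ 2) * w)
    derivative = solve-∀

    step-drift : ∀ x x₀ d w → x - d * w - x₀ ≡ (x - x₀) * 1ℤ + d * - w
    step-drift = solve-∀

    L∣L^suc : ∀ k → L ∣ L ^ suc k
    L∣L^suc k = ∣m⇒∣m*n (L ^ k) ∣-refl

  approx-invariant : ∀ k → (L ^ suc k ∣ approx k * approx k - u) × (L ∣ approx k - x₀)
  approx-invariant zero = ∣-respˡ-≡ (sym (ℤₚ.*-identityʳ L)) x₀²≡u , ∣x-x L x₀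
  approx-invariant (suc k) with approx-invariant k
  ... | error , drift = ∣-respʳ-≡ (sym (step-error x u w)) (∣m∣n⇒∣m+n first second)
                      , ∣-respʳ-≡ (sym (step-drift x x₀ d w))
                                  (∣m∣n⇒∣m+n (∣m⇒∣m*n 1ℤ drift) (∣m⇒∣m*n (- w) (∣-trans (L∣L^suc k) error)))
    where
    x : ℤ
    x = approx k
    d : ℤ
    d = x * x - u
    first : L ^ suc (suc k) ∣ d * (1ℤ - (+ 2) * x * w)
    first = ∣-respˡ-≡ (ℤₚ.*-comm (L ^ suc k) L) (*-mono-∣ error
              (∣-respʳ-≡ (sym (derivative x x₀ w))
                (∣m∣n⇒∣m+n (∣m⇒∣m*n (- 1ℤ) 2x₀w≡1) (∣m⇒∣m*n (- (+ 2) * w) drift))))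
    second : L ^ suc (suc k) ∣ d * d * (w * w)
    second = ∣m⇒∣m*n (w * w)
      (∣-respˡ-≡ (ℤₚ.*-comm (L ^ suc k) L) (*-mono-∣ error (∣-trans (L∣L^suc k) error)))

  approx-coherent : ∀ k → L ^ k ∣ approx (suc k) - approx k
  approx-coherent k = ∣-respʳ-≡ (correction (approx k) (approx k * approx k - u) w)
    (∣m⇒∣m*n (- w) (∣-trans (∣n⇒∣m*n L ∣-refl) (proj₁ (approx-invariant k))))
    where
    correction : ∀ x d w → d * - w ≡ x - d * w - x
    correction = solve-∀

  approx-square : ∀ k → L ^ k ∣ approx k * approx k - u
  approx-square k = ∣-trans (∣n⇒∣m*n L ∣-refl) (proj₁ (approx-invariant k))

hensel : ∀ {ℓ u x₀} → Prime ℓ → ¬ (+ ℓ ∣ + 2) →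
         + ℓ ∣ x₀ * x₀ - u → ¬ (+ ℓ ∣ x₀) → IsAdicSquare ℓ u
hensel {ℓ} {u} {x₀} ℓ-prime ℓ∤2 x₀²≡u ℓ∤x₀ with inverse ℓ-prime ((+ 2) * x₀) (∤-* ℓ-prime ℓ∤2 ℓ∤x₀)
... | w , 2x₀w≡1 = mkZp ℓ approx approx-coherent , approx-square
  where open NewtonSqrt (+ ℓ) u x₀ w x₀²≡u 2x₀w≡1

-- (1 + 4t)² = 1 + 8(2t² + t), so a 2-adic root of g t = 2t² + t - r gives √(1 + 8r); as g′ t = 4t + 1 is odd,
-- Newton's iteration for g needs no inverse modulo 2.
module DyadicNewton (r : ℤ) where

  opaque
    g : ℤ → ℤ
    g t = (+ 2) * t * t + t - r

  opaque
    unfolding g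

    g-step : ∀ t → g (t - g t) ≡ (+ 2) * g t * (g t - (+ 2) * t)
    g-step t = expand t r
      where
      expand : ∀ t r → let d = (+ 2) * t * t + t - r in
        (+ 2) * (t - d) * (t - d) + (t - d) - r ≡ (+ 2) * d * (d - (+ 2) * t)
      expand = solve-∀

    g-square : ∀ t → g t * (+ 8) ≡ (1ℤ + (+ 4) * t) * (1ℤ + (+ 4) * t) - (1ℤ + (+ 8) * r)
    g-square t = expand t r
      where
      expand : ∀ t r → ((+ 2) * t * t + t - r) * (+ 8) ≡
                       (1ℤ + (+ 4) * t) * (1ℤ + (+ 4) * t) - (1ℤ + (+ 8) * r)
      expand = solve-∀

  root : ℕ → ℤ
  root zero    = 0ℤ
  root (suc k) = root k - g (root k)

  root-approx : ∀ k → (+ 2) ^ k ∣ g (root k)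
  root-approx zero    = ∣ᵤ⇒∣ (ℕᵈ.1∣ _)
  root-approx (suc k) = ∣-respʳ-≡ (sym (g-step (root k)))
    (∣m⇒∣m*n (g (root k) - (+ 2) * root k) (*-mono-∣ (∣-refl {+ 2}) (root-approx k)))

1+8r-isAdicSquare : ∀ r → IsAdicSquare 2 (1ℤ + (+ 8) * r)
1+8r-isAdicSquare r = mkZp 2 b coherent , square
  where
  open DyadicNewton r
  b : ℕ → ℤ
  b k = 1ℤ + (+ 4) * root k

  coherent : ∀ k → (+ 2) ^ k ∣ b (suc k) - b k
  coherent k = ∣-respʳ-≡ (difference (root k) (g (root k))) (∣m⇒∣m*n (- (+ 4)) (root-approx k))
    where
    difference : ∀ t d → d * - (+ 4) ≡ 1ℤ + (+ 4) * (t - d) - (1ℤ + (+ 4) * t)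
    difference = solve-∀

  square : ∀ k → (+ 2) ^ k ∣ b k * b k - (1ℤ + (+ 8) * r)
  square k = ∣-respʳ-≡ (g-square (root k)) (∣m⇒∣m*n (+ 8) (root-approx k))

isAdicSquare-*-square : ∀ {v u} d → IsAdicSquare v u → IsAdicSquare v (d * d * u)
isAdicSquare-*-square {v} {u} d (b , square) =
  mkZp v (λ k → d * digit b k) coherent , λ k → ∣-respʳ-≡ (factor d (digit b k) u) (∣n⇒∣m*n (d * d) (square k))
  where
  coherent : ∀ k → (+ v) ^ k ∣ d * digit b (suc k) - d * digit b k
  coherent k = ∣-respʳ-≡ (distrib d _ _) (∣n⇒∣m*n d (∣-respˡ-≡ (pos-^ v k) (∣ᵤ⇒∣ (coh b k))))
    where
    distrib : ∀ d x y → d * (x - y) ≡ d * x - d * y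
    distrib = solve-∀
  factor : ∀ d x u → d * d * (x * x - u) ≡ d * x * (d * x) - d * d * u
  factor = solve-∀

-- q⁴ f(a / q), with f as above.
binaryQuartic : ℤ → ℤ → ℤ → ℤ
binaryQuartic c a q = (+ 2) * (a * a * a * a) - (+ 2) * c * (a * a) * (q * q) + (+ 2) * (q * q * q * q)

^-2* : ∀ x m → x ^ (2 ℕ.* m) ≡ x ^ m * x ^ m
^-2* x m = trans (cong (x ^_) (ℕₚ.*-comm 2 m)) (trans (sym (ℤₚ.^-*-assoc x m 2)) (x^2≡x*x (x ^ m)))

^-4* : ∀ x m → x ^ (4 ℕ.* m) ≡ x ^ m * x ^ m * x ^ m * x ^ m
^-4* x m = trans (cong (x ^_) (ℕₚ.*-comm 4 m)) (trans (sym (ℤₚ.^-*-assoc x m 4)) (x^4≡x*x*x*x (x ^ m)))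

point-defect : ∀ V c m n a b → let Q = V ^ m ; R = V ^ n in
  b ^ 2 * V ^ (4 ℕ.* m)
    - V ^ (2 ℕ.* n) * ((+ 2) * a ^ 4 - (+ 2) * c * a ^ 2 * V ^ (2 ℕ.* m) + (+ 2) * V ^ (4 ℕ.* m))
  ≡ b * b * (Q * Q * Q * Q) - R * R * binaryQuartic c a Q
point-defect V c m n a b
  rewrite x^2≡x*x b | x^4≡x*x*x*x a | x^2≡x*x a | ^-4* V m | ^-2* V m | ^-2* V n = refl

binaryQuartic-square⇒point : ∀ v c m → IsAdicSquare v (binaryQuartic c 1ℤ ((+ v) ^ m)) → HasQvPoint v c
binaryQuartic-square⇒point v c m (b , square) = m , 2 ℕ.* m , constZp v 1ℤ , b , λ k →
  ∣⇒∣ᵤ (∣-respˡ-≡ (sym (pos-^ v k)) (∣-respʳ-≡ (sym (defect k)) (∣m⇒∣m*n _ (square k))))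
  where
  Q : ℤ
  Q = (+ v) ^ m
  factor : ∀ b Q u → (b * b - u) * (Q * Q * Q * Q) ≡ b * b * (Q * Q * Q * Q) - Q * Q * (Q * Q) * u
  factor = solve-∀
  defect : ∀ k → _ ≡ (digit b k * digit b k - binaryQuartic c 1ℤ Q) * (Q * Q * Q * Q)
  defect k = begin
    _ ≡⟨ point-defect (+ v) c m (2 ℕ.* m) 1ℤ (digit b k) ⟩
    digit b k * digit b k * (Q * Q * Q * Q) - (+ v) ^ (2 ℕ.* m) * (+ v) ^ (2 ℕ.* m) * binaryQuartic c 1ℤ Q
      ≡⟨ cong (λ R → digit b k * digit b k * (Q * Q * Q * Q) - R * R * binaryQuartic c 1ℤ Q) (^-2* (+ v) m) ⟩
    digit b k * digit b k * (Q * Q * Q * Q) - Q * Q * (Q * Q) * binaryQuartic c 1ℤ Q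
      ≡⟨ sym (factor (digit b k) Q (binaryQuartic c 1ℤ Q)) ⟩
    (digit b k * digit b k - binaryQuartic c 1ℤ Q) * (Q * Q * Q * Q) ∎
    where open ≡-Reasoning

two-square⇒point : ∀ {ℓ} c → Prime ℓ → ¬ (+ ℓ ∣ + 2) → (∃ λ x → + ℓ ∣ x * x - + 2) → HasQvPoint ℓ c
two-square⇒point {ℓ} c ℓ-prime ℓ∤2 (x₀ , x₀²≡2) =
  binaryQuartic-square⇒point ℓ c 1 (hensel ℓ-prime ℓ∤2 x₀²≡f ℓ∤x₀)
  where
  L : ℤ
  L = + ℓ
  reduce : ∀ x L c → x * x - ((+ 2) * (1ℤ * 1ℤ * 1ℤ * 1ℤ) - (+ 2) * c * (1ℤ * 1ℤ) * (L * 1ℤ * (L * 1ℤ))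
                              + (+ 2) * (L * 1ℤ * (L * 1ℤ) * (L * 1ℤ) * (L * 1ℤ)))
                   ≡ x * x - + 2 + L * ((+ 2) * c * L - (+ 2) * (L * L * L))
  reduce = solve-∀
  x₀²≡f : L ∣ x₀ * x₀ - binaryQuartic c 1ℤ (L ^ 1)
  x₀²≡f = ∣-respʳ-≡ (sym (reduce x₀ L c)) (∣m∣n⇒∣m+n x₀²≡2 (∣m⇒∣m*n _ ∣-refl))
  cancel : ∀ x → x * x - (x * x - + 2) ≡ + 2
  cancel = solve-∀
  ℓ∤x₀ : ¬ (L ∣ x₀)
  ℓ∤x₀ ℓ∣x₀ = ℓ∤2 (∣-respʳ-≡ (cancel x₀) (∣m∣n⇒∣m-n (∣m⇒∣m*n x₀ ℓ∣x₀) x₀²≡2))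

dyadic-point : ∀ r → HasQvPoint 2 ((+ 16) * r)
dyadic-point r = binaryQuartic-square⇒point 2 ((+ 16) * r) 0
  (subst (IsAdicSquare 2) (expand r) (isAdicSquare-*-square (+ 2) (1+8r-isAdicSquare (- r))))
  where
  expand : ∀ r → (+ 2) * (+ 2) * (1ℤ + (+ 8) * - r) ≡
    (+ 2) * (1ℤ * 1ℤ * 1ℤ * 1ℤ) - (+ 2) * ((+ 16) * r) * (1ℤ * 1ℤ) * (1ℤ * 1ℤ) + (+ 2) * (1ℤ * 1ℤ * 1ℤ * 1ℤ)
  expand = solve-∀

-- Valuations at an odd prime

^-monoʳ-∣ : ∀ x {a b} → a ≤ b → x ^ a ∣ x ^ b
^-monoʳ-∣ x {a} {b} a≤b = divides (x ^ (b ℕ.∸ a)) (begin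
  x ^ b                 ≡⟨ cong (x ^_) (sym (ℕₚ.m+[n∸m]≡n a≤b)) ⟩
  x ^ (a ℕ.+ (b ℕ.∸ a)) ≡⟨ ℤₚ.^-distribˡ-+-* x a (b ℕ.∸ a) ⟩
  x ^ a * x ^ (b ℕ.∸ a) ≡⟨ ℤₚ.*-comm (x ^ a) (x ^ (b ℕ.∸ a)) ⟩
  x ^ (b ℕ.∸ a) * x ^ a ∎)
  where open ≡-Reasoning

^-cancel-∣ : ∀ x .{{_ : ℤ.NonZero x}} a y → x ^ suc a ∣ x ^ a * y → x ∣ y
^-cancel-∣ x zero    y x∣y = ∣-respʳ-≡ (ℤₚ.*-identityˡ y) (∣-respˡ-≡ (ℤₚ.*-identityʳ x) x∣y)
^-cancel-∣ x (suc a) y x^a∣y = ^-cancel-∣ x a y (*-cancelˡ-∣ x (∣-respʳ-≡ (ℤₚ.*-assoc x (x ^ a) y) x^a∣y))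

module OddPrime {ℓ : ℕ} (ℓ-prime : Prime ℓ) (ℓ∤2 : ¬ (+ ℓ ∣ + 2)) where

  private
    L : ℤ
    L = + ℓ

    instance
      L-nonZero : ℤ.NonZero L
      L-nonZero = prime⇒nonZero ℓ-prime

  HasValuation : ℤ → ℕ → Set
  HasValuation X t = Σ ℤ λ X₀ → X ≡ L ^ t * X₀ × ¬ (L ∣ X₀)

  valuation-< : ∀ T X → L ^ T ∣ X ⊎ Σ ℕ λ t → t < T × HasValuation X t
  valuation-< zero    X = inj₁ (divides X (sym (ℤₚ.*-identityʳ X)))
  valuation-< (suc T) X with valuation-< T X
  ... | inj₂ (t , t<T , v) = inj₂ (t , ℕₚ.m≤n⇒m≤1+n t<T , v)
  ... | inj₁ (divides q X≡qL^T) with L ∣? q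
  ...   | yes (divides r q≡rL) = inj₁ (divides r (trans X≡qL^T
                                   (trans (cong (_* L ^ T) q≡rL) (ℤₚ.*-assoc r L (L ^ T)))))
  ...   | no L∤q = inj₂ (T , ℕₚ.≤-refl , q , trans X≡qL^T (ℤₚ.*-comm q (L ^ T)) , L∤q)

  unit-parts-agree : ∀ {K M N X Y} → M < K → N < K → ¬ (L ∣ X) → ¬ (L ∣ Y) →
                     L ^ K ∣ L ^ M * X - L ^ N * Y → M ≡ N × L ∣ X - Y
  unit-parts-agree {K} {M} {N} {X} {Y} M<K N<K L∤X L∤Y L^K∣diff with ℕₚ.<-cmp M N
  ... | tri< M<N _ _ = ⊥-elim (L∤X (^-cancel-∣ L M X (∣-respʳ-≡ (restore (L ^ M * X) (L ^ N * Y))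
          (∣m∣n⇒∣m+n (∣-trans (^-monoʳ-∣ L M<K) L^K∣diff) (∣-trans (^-monoʳ-∣ L M<N) (∣m⇒∣m*n Y ∣-refl))))))
    where
    restore : ∀ a b → a - b + b ≡ a
    restore = solve-∀
  ... | tri> _ _ N<M = ⊥-elim (L∤Y (^-cancel-∣ L N Y (∣-respʳ-≡ (restore (L ^ M * X) (L ^ N * Y))
          (∣m∣n⇒∣m-n (∣-trans (^-monoʳ-∣ L N<M) (∣m⇒∣m*n X ∣-refl)) (∣-trans (^-monoʳ-∣ L N<K) L^K∣diff)))))
    where
    restore : ∀ a b → a - (a - b) ≡ b
    restore = solve-∀
  ... | tri≈ _ refl _ = refl , ^-cancel-∣ L M (X - Y)
          (∣-respʳ-≡ (factor (L ^ M) X Y) (∣-trans (^-monoʳ-∣ L M<K) L^K∣diff))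
    where
    factor : ∀ a x y → a * x - a * y ≡ a * (x - y)
    factor = solve-∀

  unit-∤ : ∀ {u} → u * u ≡ 1ℤ → ¬ (L ∣ u)
  unit-∤ {u} u²≡1 L∣u = ℓ∤2 (∣-respʳ-≡ (cong ((+ 2) *_) u²≡1) (∣n⇒∣m*n (+ 2) (∣m⇒∣m*n u L∣u)))

  IsTwiceSquare : ℤ → Set
  IsTwiceSquare E = Σ ℤ λ s → ¬ (L ∣ s) × L ∣ E - (+ 2) * (s * s)

  twiceSquare-∤ : ∀ {E} → IsTwiceSquare E → ¬ (L ∣ E)
  twiceSquare-∤ {E} (s , L∤s , E≡2s²) L∣E =
    ∤-* ℓ-prime ℓ∤2 (∤-* ℓ-prime L∤s L∤s) (∣-respʳ-≡ (cancel E _) (∣m∣n⇒∣m-n L∣E E≡2s²))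
    where
    cancel : ∀ e t → e - (e - t) ≡ t
    cancel = solve-∀

  module _ {τ σ : ℤ} (τ²≡1 : τ * τ ≡ 1ℤ) (σ²≡1 : σ * σ ≡ 1ℤ) where

    private
      c : ℤ
      c = (+ 2) * τ + (+ 2) * σ * L

    record QuarticValuation (m : ℕ) (A : ℤ) : Set where
      field
        e         : ℕ
        e≤4m+1    : e ≤ 4 ℕ.* m ℕ.+ 1
        valuation : HasValuation (binaryQuartic c A (L ^ m)) e
        twiceSquare-or-odd : IsTwiceSquare (proj₁ valuation) ⊎ e ≡ 4 ℕ.* m ℕ.+ 1

    private
      homogeneous : ∀ P a d → binaryQuartic c (P * a) (P * d) ≡ P * P * P * P * binaryQuartic c a d
      homogeneous P a d = expand P a d c
        where
        expand : ∀ P a d c →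
          (+ 2) * (P * a * (P * a) * (P * a) * (P * a)) - (+ 2) * c * (P * a * (P * a)) * (P * d * (P * d))
            + (+ 2) * (P * d * (P * d) * (P * d) * (P * d))
          ≡ P * P * P * P * ((+ 2) * (a * a * a * a) - (+ 2) * c * (a * a) * (d * d) + (+ 2) * (d * d * d * d))
        expand = solve-∀

      -- Since c ≡ 2τ and τ² = 1 modulo L, the quartic is 2(q² - τ)² modulo L.
      near-τ : ∀ q → binaryQuartic c q 1ℤ ≡ (+ 2) * ((q * q - τ) * (q * q - τ)) + L * (- (+ 4) * σ * (q * q))
      near-τ q = begin
        binaryQuartic c q 1ℤ
          ≡⟨ expand q τ σ L ⟩
        (+ 2) * ((q * q - τ) * (q * q - τ)) + L * (- (+ 4) * σ * (q * q)) + (+ 2) * (1ℤ - τ * τ)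
          ≡⟨ cong (λ t → (+ 2) * ((q * q - τ) * (q * q - τ)) + L * (- (+ 4) * σ * (q * q)) + (+ 2) * (1ℤ - t)) τ²≡1 ⟩
        (+ 2) * ((q * q - τ) * (q * q - τ)) + L * (- (+ 4) * σ * (q * q)) + (+ 2) * (1ℤ - 1ℤ)
          ≡⟨ drop _ ⟩
        (+ 2) * ((q * q - τ) * (q * q - τ)) + L * (- (+ 4) * σ * (q * q)) ∎
        where
        open ≡-Reasoning
        expand : ∀ q τ σ L →
          (+ 2) * (q * q * q * q) - (+ 2) * ((+ 2) * τ + (+ 2) * σ * L) * (q * q) * (1ℤ * 1ℤ)
            + (+ 2) * (1ℤ * 1ℤ * 1ℤ * 1ℤ)
          ≡ (+ 2) * ((q * q - τ) * (q * q - τ)) + L * (- (+ 4) * σ * (q * q)) + (+ 2) * (1ℤ - τ * τ)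
        expand = solve-∀
        drop : ∀ x → x + (+ 2) * (1ℤ - 1ℤ) ≡ x
        drop = solve-∀

      at-multiple : ∀ m q → binaryQuartic c (q * L ^ m) (L ^ m) ≡ L ^ (4 ℕ.* m) * binaryQuartic c q 1ℤ
      at-multiple m q = begin
        binaryQuartic c (q * L ^ m) (L ^ m)
          ≡⟨ cong₂ (binaryQuartic c) (ℤₚ.*-comm q (L ^ m)) (sym (ℤₚ.*-identityʳ (L ^ m))) ⟩
        binaryQuartic c (L ^ m * q) (L ^ m * 1ℤ)
          ≡⟨ homogeneous (L ^ m) q 1ℤ ⟩
        L ^ m * L ^ m * L ^ m * L ^ m * binaryQuartic c q 1ℤ
          ≡⟨ cong (_* binaryQuartic c q 1ℤ) (sym (^-4* L m)) ⟩
        L ^ (4 ℕ.* m) * binaryQuartic c q 1ℤ ∎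
        where open ≡-Reasoning

    quarticValuation-off-τ : ∀ m q → ¬ (L ∣ q * q - τ) → QuarticValuation m (q * L ^ m)
    quarticValuation-off-τ m q L∤s = record
      { e = 4 ℕ.* m
      ; e≤4m+1 = ℕₚ.m≤m+n (4 ℕ.* m) 1
      ; valuation = binaryQuartic c q 1ℤ , at-multiple m q , twiceSquare-∤ twiceSquare
      ; twiceSquare-or-odd = inj₁ twiceSquare
      }
      where
      s : ℤ
      s = q * q - τ
      twiceSquare : IsTwiceSquare (binaryQuartic c q 1ℤ)
      twiceSquare = s , L∤s , ∣-respʳ-≡ (sym (cancel (near-τ q))) (∣m⇒∣m*n _ ∣-refl)
        where
        cancel : ∀ {x y z} → x ≡ y + z → x - y ≡ z
        cancel {x} {y} {z} refl = shift y z
          where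
          shift : ∀ y z → y + z - y ≡ z
          shift = solve-∀

    quarticValuation-at-τ : ∀ m q → L ∣ q * q - τ → QuarticValuation m (q * L ^ m)
    quarticValuation-at-τ m q (divides g s≡gL) = record
      { e = 4 ℕ.* m ℕ.+ 1
      ; e≤4m+1 = ℕₚ.≤-refl
      ; valuation = E , valuation , L∤E
      ; twiceSquare-or-odd = inj₂ refl
      }
      where
      E : ℤ
      E = (+ 2) * (g * g) * L - (+ 4) * σ * (q * q)
      valuation : binaryQuartic c (q * L ^ m) (L ^ m) ≡ L ^ (4 ℕ.* m ℕ.+ 1) * E
      valuation = begin
        binaryQuartic c (q * L ^ m) (L ^ m)   ≡⟨ at-multiple m q ⟩
        L ^ (4 ℕ.* m) * binaryQuartic c q 1ℤ  ≡⟨ cong (L ^ (4 ℕ.* m) *_) (near-τ q) ⟩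
        L ^ (4 ℕ.* m) * ((+ 2) * ((q * q - τ) * (q * q - τ)) + L * (- (+ 4) * σ * (q * q)))
          ≡⟨ cong (λ t → L ^ (4 ℕ.* m) * ((+ 2) * (t * t) + L * (- (+ 4) * σ * (q * q)))) s≡gL ⟩
        L ^ (4 ℕ.* m) * ((+ 2) * (g * L * (g * L)) + L * (- (+ 4) * σ * (q * q)))
          ≡⟨ factor (L ^ (4 ℕ.* m)) L g σ q ⟩
        L ^ (4 ℕ.* m) * (L * 1ℤ) * E
          ≡⟨ cong (_* E) (sym (ℤₚ.^-distribˡ-+-* L (4 ℕ.* m) 1)) ⟩
        L ^ (4 ℕ.* m ℕ.+ 1) * E ∎
        where
        open ≡-Reasoning
        factor : ∀ P L g σ q → P * ((+ 2) * (g * L * (g * L)) + L * (- (+ 4) * σ * (q * q)))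
                               ≡ P * (L * 1ℤ) * ((+ 2) * (g * g) * L - (+ 4) * σ * (q * q))
        factor = solve-∀
      L∤q : ¬ (L ∣ q)
      L∤q L∣q = unit-∤ τ²≡1 (∣-respʳ-≡ (cancel q τ) (∣m∣n⇒∣m-n (∣m⇒∣m*n q L∣q) (divides g s≡gL)))
        where
        cancel : ∀ q τ → q * q - (q * q - τ) ≡ τ
        cancel = solve-∀
      L∤4σ : ¬ (L ∣ (+ 4) * σ)
      L∤4σ = ∤-* ℓ-prime {a = + 4} (∤-* ℓ-prime ℓ∤2 ℓ∤2) (unit-∤ σ²≡1)
      L∤E : ¬ (L ∣ E)
      L∤E L∣E = ∤-* ℓ-prime L∤4σ (∤-* ℓ-prime L∤q L∤q)
        (∣-respʳ-≡ (cancel (+ 2) g L E σ q) (∣m∣n⇒∣m-n (∣n⇒∣m*n ((+ 2) * (g * g)) ∣-refl) L∣E))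
        where
        cancel : ∀ t g L E σ q → t * (g * g) * L - (t * (g * g) * L - (+ 4) * σ * (q * q)) ≡ (+ 4) * σ * (q * q)
        cancel = solve-∀

    quarticValuation-below : ∀ m j A₀ → j < m → ¬ (L ∣ A₀) → QuarticValuation m (L ^ j * A₀)
    quarticValuation-below m j A₀ j<m L∤A₀ = record
      { e = 4 ℕ.* j
      ; e≤4m+1 = ℕₚ.≤-trans (ℕₚ.*-monoʳ-≤ 4 (ℕₚ.<⇒≤ j<m)) (ℕₚ.m≤m+n (4 ℕ.* m) 1)
      ; valuation = E , valuation , twiceSquare-∤ twiceSquare
      ; twiceSquare-or-odd = inj₁ twiceSquare
      }
      where
      d : ℕ
      d = m ℕ.∸ suc j
      D : ℤ
      D = L * L ^ d
      E : ℤ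
      E = binaryQuartic c A₀ D
      L^m≡L^jD : L ^ m ≡ L ^ j * D
      L^m≡L^jD = trans (cong (L ^_) (sym (trans (ℕₚ.+-suc j d) (ℕₚ.m+[n∸m]≡n j<m))))
                       (ℤₚ.^-distribˡ-+-* L j (suc d))
      valuation : binaryQuartic c (L ^ j * A₀) (L ^ m) ≡ L ^ (4 ℕ.* j) * E
      valuation = begin
        binaryQuartic c (L ^ j * A₀) (L ^ m)       ≡⟨ cong (binaryQuartic c (L ^ j * A₀)) L^m≡L^jD ⟩
        binaryQuartic c (L ^ j * A₀) (L ^ j * D)   ≡⟨ homogeneous (L ^ j) A₀ D ⟩
        L ^ j * L ^ j * L ^ j * L ^ j * E          ≡⟨ cong (_* E) (sym (^-4* L j)) ⟩
        L ^ (4 ℕ.* j) * E                          ∎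
        where open ≡-Reasoning
      twiceSquare : IsTwiceSquare E
      twiceSquare = A₀ * A₀ , ∤-* ℓ-prime L∤A₀ L∤A₀ ,
        ∣-respʳ-≡ (sym (expand A₀ D c)) (∣m⇒∣m*n _ (∣m⇒∣m*n (L ^ d) ∣-refl))
        where
        expand : ∀ a D c → (+ 2) * (a * a * a * a) - (+ 2) * c * (a * a) * (D * D) + (+ 2) * (D * D * D * D)
                             - (+ 2) * (a * a * (a * a))
                           ≡ D * (D * ((+ 2) * (D * D) - (+ 2) * c * (a * a)))
        expand = solve-∀

    quarticValuation : ∀ m A → QuarticValuation m A
    quarticValuation m A with valuation-< m A
    ... | inj₁ (divides q refl) with L ∣? (q * q - τ)
    ...   | yes L∣s = quarticValuation-at-τ m q L∣s
    ...   | no L∤s  = quarticValuation-off-τ m q L∤s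
    quarticValuation m A | inj₂ (j , j<m , A₀ , refl , L∤A₀) = quarticValuation-below m j A₀ j<m L∤A₀

    private
      power-square : ∀ t m X → L ^ t * X * (L ^ t * X) * (L ^ m * L ^ m * L ^ m * L ^ m)
                               ≡ L ^ (2 ℕ.* t ℕ.+ 4 ℕ.* m) * (X * X)
      power-square t m X = begin
        L ^ t * X * (L ^ t * X) * (L ^ m * L ^ m * L ^ m * L ^ m)
          ≡⟨ rearrange (L ^ t) (L ^ m) X ⟩
        L ^ t * L ^ t * (L ^ m * L ^ m * L ^ m * L ^ m) * (X * X)
          ≡⟨ cong₂ (λ u v → u * v * (X * X)) (sym (^-2* L t)) (sym (^-4* L m)) ⟩
        L ^ (2 ℕ.* t) * L ^ (4 ℕ.* m) * (X * X)
          ≡⟨ cong (_* (X * X)) (sym (ℤₚ.^-distribˡ-+-* L (2 ℕ.* t) (4 ℕ.* m))) ⟩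
        L ^ (2 ℕ.* t ℕ.+ 4 ℕ.* m) * (X * X) ∎
        where
        open ≡-Reasoning
        rearrange : ∀ P Q X → P * X * (P * X) * (Q * Q * Q * Q) ≡ P * P * (Q * Q * Q * Q) * (X * X)
        rearrange = solve-∀

      power-scale : ∀ n e E → L ^ n * L ^ n * (L ^ e * E) ≡ L ^ (2 ℕ.* n ℕ.+ e) * E
      power-scale n e E = begin
        L ^ n * L ^ n * (L ^ e * E)   ≡⟨ sym (ℤₚ.*-assoc (L ^ n * L ^ n) (L ^ e) E) ⟩
        L ^ n * L ^ n * L ^ e * E     ≡⟨ cong (λ u → u * L ^ e * E) (sym (^-2* L n)) ⟩
        L ^ (2 ℕ.* n) * L ^ e * E     ≡⟨ cong (_* E) (sym (ℤₚ.^-distribˡ-+-* L (2 ℕ.* n) e)) ⟩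
        L ^ (2 ℕ.* n ℕ.+ e) * E       ∎
        where open ≡-Reasoning

      square-root-of-two : ∀ B₀ E s → L ∣ B₀ * B₀ - E → L ∣ E - (+ 2) * (s * s) → ¬ (L ∣ s) →
                           ∃ λ x → L ∣ x * x - + 2
      square-root-of-two B₀ E s B₀²≡E E≡2s² L∤s with inverse ℓ-prime s L∤s
      ... | w , sw≡1 = B₀ * w , ∣-respʳ-≡ (sym (expand B₀ w s E))
          (∣m∣n⇒∣m+n (∣n⇒∣m*n (w * w) (∣m∣n⇒∣m+n B₀²≡E E≡2s²)) (∣m⇒∣m*n ((+ 2) * (s * w + 1ℤ)) sw≡1))
        where
        expand : ∀ b w s E → b * w * (b * w) - + 2
                             ≡ w * w * (b * b - E + (E - (+ 2) * (s * s))) + (s * w - 1ℤ) * ((+ 2) * (s * w + 1ℤ))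
        expand = solve-∀

      two-square-from-valuations : ∀ {m n A B} → QuarticValuation m A →
        (L ^ suc n ∣ B ⊎ Σ ℕ λ t → t < suc n × HasValuation B t) →
        L ^ (2 ℕ.* n ℕ.+ 4 ℕ.* m ℕ.+ 2) ∣
          B * B * (L ^ m * L ^ m * L ^ m * L ^ m) - L ^ n * L ^ n * binaryQuartic c A (L ^ m) →
        ∃ λ x → L ∣ x * x - + 2
      two-square-from-valuations {m} {n} {A} {B} v B-valuation on-curve =
        [ divisible-impossible , from-unit-part ]′ B-valuation
        where
        open QuarticValuation v
        E : ℤ
        E = proj₁ valuation
        L∤E : ¬ (L ∣ E)
        L∤E = proj₂ (proj₂ valuation)
        K : ℕ
        K = 2 ℕ.* n ℕ.+ 4 ℕ.* m ℕ.+ 2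
        N : ℕ
        N = 2 ℕ.* n ℕ.+ e
        Q⁴ : ℤ
        Q⁴ = L ^ m * L ^ m * L ^ m * L ^ m

        N<K : N < K
        N<K = ℕₚ.≤-<-trans (ℕₚ.+-monoʳ-≤ (2 ℕ.* n) e≤4m+1)
                (subst (_< K) (ℕₚ.+-assoc (2 ℕ.* n) (4 ℕ.* m) 1)
                   (ℕₚ.+-monoʳ-< (2 ℕ.* n ℕ.+ 4 ℕ.* m) ℕₚ.≤-refl))

        on-curve′ : L ^ K ∣ B * B * Q⁴ - L ^ N * E
        on-curve′ = ∣-respʳ-≡ (cong (λ z → B * B * Q⁴ - z)
                      (trans (cong (L ^ n * L ^ n *_) (proj₁ (proj₂ valuation))) (power-scale n e E)))
                      on-curve

        divisible-impossible : L ^ suc n ∣ B → ∃ λ x → L ∣ x * x - + 2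
        divisible-impossible (divides β B≡βL^n+1) = ⊥-elim (L∤E (^-cancel-∣ L N E
          (∣-trans (^-monoʳ-∣ L N<K) (∣-respʳ-≡ (cancel (B * B * Q⁴) (L ^ N * E))
            (∣m∣n⇒∣m-n (∣-respʳ-≡ (sym B²Q⁴≡L^Kβ²) (∣m⇒∣m*n (β * β) ∣-refl)) on-curve′)))))
          where
          cancel : ∀ x y → x - (x - y) ≡ y
          cancel = solve-∀
          2[n+1]+4m≡K : ∀ n m → 2 ℕ.* suc n ℕ.+ 4 ℕ.* m ≡ 2 ℕ.* n ℕ.+ 4 ℕ.* m ℕ.+ 2
          2[n+1]+4m≡K = ℕ-Solver.solve-∀
          B²Q⁴≡L^Kβ² : B * B * Q⁴ ≡ L ^ K * (β * β)
          B²Q⁴≡L^Kβ² = begin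
            B * B * Q⁴
              ≡⟨ cong (λ u → u * u * Q⁴) (trans B≡βL^n+1 (ℤₚ.*-comm β (L ^ suc n))) ⟩
            L ^ suc n * β * (L ^ suc n * β) * Q⁴        ≡⟨ power-square (suc n) m β ⟩
            L ^ (2 ℕ.* suc n ℕ.+ 4 ℕ.* m) * (β * β)     ≡⟨ cong (λ k → L ^ k * (β * β)) (2[n+1]+4m≡K n m) ⟩
            L ^ K * (β * β)                             ∎
            where open ≡-Reasoning

        from-unit-part : (Σ ℕ λ t → t < suc n × HasValuation B t) → ∃ λ x → L ∣ x * x - + 2
        from-unit-part (t , t<n+1 , B₀ , B≡L^tB₀ , L∤B₀) =
          let M≡N , B₀²≡E = unit-parts-agree M<K N<K (∤-* ℓ-prime L∤B₀ L∤B₀) L∤E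
                              (∣-respʳ-≡ (cong (_- L ^ N * E) B²Q⁴≡L^Mβ²) on-curve′)
          in [ (λ (s , L∤s , E≡2s²) → square-root-of-two B₀ E s B₀²≡E E≡2s² L∤s)
             , (λ e≡4m+1 → ⊥-elim (ℕₚ.even≢odd (t ℕ.+ 2 ℕ.* m) (n ℕ.+ 2 ℕ.* m)
                 (trans (even t m) (trans M≡N (trans (cong (2 ℕ.* n ℕ.+_) e≡4m+1) (odd n m))))))
             ]′ twiceSquare-or-odd
          where
          M<K : 2 ℕ.* t ℕ.+ 4 ℕ.* m < K
          M<K = ℕₚ.≤-<-trans (ℕₚ.+-monoˡ-≤ (4 ℕ.* m) (ℕₚ.*-monoʳ-≤ 2 (ℕₚ.≤-pred t<n+1)))
                  (ℕₚ.m<m+n (2 ℕ.* n ℕ.+ 4 ℕ.* m) (s≤s z≤n))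
          B²Q⁴≡L^Mβ² : B * B * Q⁴ ≡ L ^ (2 ℕ.* t ℕ.+ 4 ℕ.* m) * (B₀ * B₀)
          B²Q⁴≡L^Mβ² = trans (cong (λ u → u * u * Q⁴) B≡L^tB₀) (power-square t m B₀)
          even : ∀ t m → 2 ℕ.* (t ℕ.+ 2 ℕ.* m) ≡ 2 ℕ.* t ℕ.+ 4 ℕ.* m
          even = ℕ-Solver.solve-∀
          odd : ∀ n m → 2 ℕ.* n ℕ.+ (4 ℕ.* m ℕ.+ 1) ≡ suc (2 ℕ.* (n ℕ.+ 2 ℕ.* m))
          odd = ℕ-Solver.solve-∀

    point⇒two-square : HasQvPoint ℓ ((+ 2) * τ + (+ 2) * σ * + ℓ) → ∃ λ x → L ∣ x * x - + 2
    point⇒two-square (m , n , a , b , on-curve) =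
      two-square-from-valuations (quarticValuation m A) (valuation-< (suc n) B)
        (∣-respʳ-≡ (point-defect L c m n A B) (∣-respˡ-≡ (pos-^ ℓ K) (∣ᵤ⇒∣ (on-curve K))))
      where
      K : ℕ
      K = 2 ℕ.* n ℕ.+ 4 ℕ.* m ℕ.+ 2
      A : ℤ
      A = digit a K
      B : ℤ
      B = digit b K

-- The second supplement to quadratic reciprocity

Odd : ℕ → Set
Odd n = n ℕ.% 2 ≡ 1

±1-mod-8 : ℕ → Set
±1-mod-8 n = n ℕ.% 8 ≡ 1 ⊎ n ℕ.% 8 ≡ 7

private
  Mod8Descent : ℕ → ℕ → ℕ → Set
  Mod8Descent y m n = Odd y → (y ℕ.* y) ℕ.% 8 ≡ (m ℕ.* n ℕ.+ 2) ℕ.% 8 →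
                      Odd m × (m ≡ 1 ⊎ m ≡ 7 → n ≡ 1 ⊎ n ≡ 7)

  mod8Descent? : ∀ y m n → Dec (Mod8Descent y m n)
  mod8Descent? y m n = (y ℕ.% 2 ℕ.≟ 1) →-dec ((y ℕ.* y) ℕ.% 8 ℕ.≟ (m ℕ.* n ℕ.+ 2) ℕ.% 8 →-dec
    ((m ℕ.% 2 ℕ.≟ 1) ×-dec (((m ℕ.≟ 1) ⊎-dec (m ℕ.≟ 7)) →-dec ((n ℕ.≟ 1) ⊎-dec (n ℕ.≟ 7)))))

  mod8Descent-table : All (λ y → All (λ m → All (Mod8Descent y m) (upTo 8)) (upTo 8)) (upTo 8)
  mod8Descent-table = toWitness {a? = all? (λ y → all? (λ m → all? (mod8Descent? y m) (upTo 8)) (upTo 8)) (upTo 8)} _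

  %8%2 : ∀ y → y ℕ.% 8 ℕ.% 2 ≡ y ℕ.% 2
  %8%2 y = m∣n⇒o%n%m≡o%m 2 8 y (ℕᵈ.divides 4 refl)

  mod8-descent : ∀ y m n → Odd y → y ℕ.* y ≡ m ℕ.* n ℕ.+ 2 → Odd m × (±1-mod-8 m → ±1-mod-8 n)
  mod8-descent y m n y-odd y²≡mn+2 =
    let m%8-odd , ±1-lifts = table-entry (trans (%8%2 y) y-odd)
                               (trans residues (sym (%-distribˡ-+ (m ℕ.% 8 ℕ.* (n ℕ.% 8)) 2 8)))
    in trans (sym (%8%2 m)) m%8-odd , ±1-lifts
    where
    table-entry : Mod8Descent (y ℕ.% 8) (m ℕ.% 8) (n ℕ.% 8)
    table-entry = All.lookup (All.lookup (All.lookup mod8Descent-table (∈-upTo⁺ (m%n<n y 8)))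
                                         (∈-upTo⁺ (m%n<n m 8))) (∈-upTo⁺ (m%n<n n 8))
    residues : (y ℕ.% 8 ℕ.* (y ℕ.% 8)) ℕ.% 8 ≡ (m ℕ.% 8 ℕ.* (n ℕ.% 8) ℕ.% 8 ℕ.+ 2) ℕ.% 8
    residues = begin
      (y ℕ.% 8 ℕ.* (y ℕ.% 8)) ℕ.% 8    ≡⟨ sym (%-distribˡ-* y y 8) ⟩
      (y ℕ.* y) ℕ.% 8                  ≡⟨ cong (ℕ._% 8) y²≡mn+2 ⟩
      (m ℕ.* n ℕ.+ 2) ℕ.% 8            ≡⟨ %-distribˡ-+ (m ℕ.* n) 2 8 ⟩
      (m ℕ.* n ℕ.% 8 ℕ.+ 2) ℕ.% 8      ≡⟨ cong (λ z → (z ℕ.+ 2) ℕ.% 8) (%-distribˡ-* m n 8) ⟩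
      (m ℕ.% 8 ℕ.* (n ℕ.% 8) ℕ.% 8 ℕ.+ 2) ℕ.% 8 ∎
      where open ≡-Reasoning

  %2≡0⊎%2≡1 : ∀ r → r ℕ.% 2 ≡ 0 ⊎ Odd r
  %2≡0⊎%2≡1 r with r ℕ.% 2 | m%n<n r 2
  ... | 0           | _ = inj₁ refl
  ... | 1           | _ = inj₂ refl
  ... | suc (suc _) | s≤s (s≤s ())

  odd-∸-even : ∀ n r → r ≤ n → Odd n → r ℕ.% 2 ≡ 0 → Odd (n ℕ.∸ r)
  odd-∸-even n r r≤n n-odd r%2≡0 = begin
    (n ℕ.∸ r) ℕ.% 2                          ≡⟨ sym (m%n%n≡m%n (n ℕ.∸ r) 2) ⟩
    (n ℕ.∸ r) ℕ.% 2 ℕ.% 2                    ≡⟨ cong (ℕ._% 2) (sym (ℕₚ.+-identityʳ ((n ℕ.∸ r) ℕ.% 2))) ⟩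
    ((n ℕ.∸ r) ℕ.% 2 ℕ.+ 0) ℕ.% 2            ≡⟨ cong (λ z → ((n ℕ.∸ r) ℕ.% 2 ℕ.+ z) ℕ.% 2) (sym r%2≡0) ⟩
    ((n ℕ.∸ r) ℕ.% 2 ℕ.+ r ℕ.% 2) ℕ.% 2      ≡⟨ sym (%-distribˡ-+ (n ℕ.∸ r) r 2) ⟩
    (n ℕ.∸ r ℕ.+ r) ℕ.% 2                    ≡⟨ cong (ℕ._% 2) (ℕₚ.m∸n+n≡m r≤n) ⟩
    n ℕ.% 2                                  ≡⟨ n-odd ⟩
    1                                        ∎
    where open ≡-Reasoning

  root-< : ∀ n .{{_ : ℕ.NonZero n}} → TwoIsSquareMod n → Σ ℕ λ r → r < n × + n ∣ + r * + r - + 2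
  root-< n (x , x²≡2) = r , n%ℕd<d x n , ∣m+n∣n⇒∣m (∣-respʳ-≡ (expand (+ r) q (+ n))
    (subst (λ z → + n ∣ z * z - + 2) (a≡a%ℕn+[a/ℕn]*n x n) x²≡2)) (∣m⇒∣m*n _ ∣-refl)
    where
    r : ℕ
    r = x ℤ.%ℕ n
    q : ℤ
    q = x ℤ./ℕ n
    expand : ∀ r q n → (r + q * n) * (r + q * n) - + 2 ≡ r * r - + 2 + n * (q * ((+ 2) * r + q * n))
    expand = solve-∀

  odd-root-≤ : ∀ n .{{_ : ℕ.NonZero n}} → Odd n → TwoIsSquareMod n →
               Σ ℕ λ y → Odd y × y ≤ n × + n ∣ + y * + y - + 2
  odd-root-≤ n n-odd x²≡2 =
    let r , r<n , r²≡2 = root-< n x²≡2 in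
    [ (λ r-even → n ℕ.∸ r , odd-∸-even n r (ℕₚ.<⇒≤ r<n) n-odd r-even , ℕₚ.m∸n≤m n r , reflected r<n r²≡2)
    , (λ r-odd → r , r-odd , ℕₚ.<⇒≤ r<n , r²≡2)
    ]′ (%2≡0⊎%2≡1 r)
    where
    reflect : ∀ r n → (n - r) * (n - r) - + 2 ≡ r * r - + 2 + n * (n - (+ 2) * r)
    reflect = solve-∀
    reflected : ∀ {r} → r < n → + n ∣ + r * + r - + 2 → + n ∣ + (n ℕ.∸ r) * + (n ℕ.∸ r) - + 2
    reflected {r} r<n r²≡2 = subst (λ z → + n ∣ z * z - + 2) (pos-∸ (ℕₚ.<⇒≤ r<n))
      (∣-respʳ-≡ (sym (reflect (+ r) (+ n))) (∣m∣n⇒∣m+n r²≡2 (∣m⇒∣m*n _ ∣-refl)))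

  descent-step : ∀ {n y} → 2 ≤ y → y ≤ n → + n ∣ + y * + y - + 2 →
                 Σ ℕ λ m → m < n × y ℕ.* y ≡ m ℕ.* n ℕ.+ 2 × + m ∣ + y * + y - + 2
  descent-step {n} {y} 2≤y y≤n n∣y²-2 = m , m<n , y²≡mn+2 , m∣y²-2
    where
    2≤y² : 2 ≤ y ℕ.* y
    2≤y² = ℕₚ.*-mono-≤ {2} {y} {1} {y} 2≤y (ℕₚ.≤-trans (s≤s z≤n) 2≤y)
    y²-2≡y²∸2 : + y * + y - + 2 ≡ + (y ℕ.* y ℕ.∸ 2)
    y²-2≡y²∸2 = trans (cong (_- + 2) (sym (ℤₚ.pos-* y y))) (pos-∸ 2≤y²)
    n∣y²∸2 : n ℕᵈ.∣ y ℕ.* y ℕ.∸ 2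
    n∣y²∸2 = ∣⇒∣ᵤ (∣-respʳ-≡ y²-2≡y²∸2 n∣y²-2)
    m : ℕ
    m = ℕᵈ._∣_.quotient n∣y²∸2
    y²∸2≡mn : y ℕ.* y ℕ.∸ 2 ≡ m ℕ.* n
    y²∸2≡mn = ℕᵈ._∣_.equality n∣y²∸2
    y²≡mn+2 : y ℕ.* y ≡ m ℕ.* n ℕ.+ 2
    y²≡mn+2 = trans (sym (ℕₚ.m∸n+n≡m 2≤y²)) (cong (ℕ._+ 2) y²∸2≡mn)
    m<n : m < n
    m<n = ℕₚ.*-cancelʳ-< n m n (ℕₚ.<-≤-trans (ℕₚ.m<m+n (m ℕ.* n) {2} (s≤s z≤n))
            (subst (_≤ n ℕ.* n) y²≡mn+2 (ℕₚ.*-mono-≤ y≤n y≤n)))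
    m∣y²-2 : + m ∣ + y * + y - + 2
    m∣y²-2 = ∣-respʳ-≡ (sym y²-2≡y²∸2) (∣ᵤ⇒∣ (ℕᵈ.divides n (trans y²∸2≡mn (ℕₚ.*-comm m n))))

two-square⇒±1-mod-8 : ∀ n → Odd n → TwoIsSquareMod n → ±1-mod-8 n
two-square⇒±1-mod-8 = <-rec _ descent
  where
  descent : ∀ n → (∀ {m} → m < n → Odd m → TwoIsSquareMod m → ±1-mod-8 m) →
            Odd n → TwoIsSquareMod n → ±1-mod-8 n
  descent 1                 _       _     _    = inj₁ refl
  descent n@(suc (suc _)) smaller n-odd x²≡2 =
    let y , y-odd , y≤n , n∣y²-2 = odd-root-≤ n n-odd x²≡2 in descend y y-odd y≤n n∣y²-2
    where
    descend : ∀ y → Odd y → y ≤ n → + n ∣ + y * + y - + 2 → ±1-mod-8 n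
    descend 1               _     _   n∣-1   = ⊥-elim (ℕₚ.<⇒≢ (s≤s (s≤s z≤n)) (sym (ℕᵈ.∣1⇒≡1 (∣⇒∣ᵤ n∣-1))))
    descend y@(suc (suc _)) y-odd y≤n n∣y²-2 =
      let m , m<n , y²≡mn+2 , m∣y²-2 = descent-step (s≤s (s≤s z≤n)) y≤n n∣y²-2
          m-odd , ±1-lifts          = mod8-descent y m n y-odd y²≡mn+2
      in ±1-lifts (smaller m<n m-odd (+ y , m∣y²-2))

-- Wilson's theorem and Euler's criterion for 2

∏ : List ℕ → ℤ
∏ []       = 1ℤ
∏ (a ∷ l) = + a * ∏ l

remove : ℕ → List ℕ → List ℕ
remove b = filter (λ x → ¬? (x ℕ.≟ b))

module _ {b : ℕ} where

  ∈-remove⁺ : ∀ {x l} → x ∈ l → x ≢ b → x ∈ remove b l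
  ∈-remove⁺ = ∈-filter⁺ (λ x → ¬? (x ℕ.≟ b))

  ∈-remove⁻ : ∀ {x l} → x ∈ remove b l → x ∈ l × x ≢ b
  ∈-remove⁻ = ∈-filter⁻ (λ x → ¬? (x ℕ.≟ b))

  remove⁺ : ∀ {l} → Unique l → Unique (remove b l)
  remove⁺ = Unique.filter⁺ (λ x → ¬? (x ℕ.≟ b))

  private
    remove-head : ∀ {l} → Unique (b ∷ l) → remove b (b ∷ l) ≡ l
    remove-head {l} (b∉l ∷ _) = trans (filter-reject (λ x → ¬? (x ℕ.≟ b)) (λ b≢b → b≢b refl))
                                     (filter-all (λ x → ¬? (x ℕ.≟ b)) (All.map (λ b≢x x≡b → b≢x (sym x≡b)) b∉l))

  ∏-remove : ∀ {l} → Unique l → b ∈ l → ∏ l ≡ + b * ∏ (remove b l)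
  ∏-remove {b ∷ l} u (here refl) = cong (λ l′ → + b * ∏ l′) (sym (remove-head u))
  ∏-remove {a ∷ l} (a∉l ∷ u) (there b∈l) = begin
    + a * ∏ l                    ≡⟨ cong (+ a *_) (∏-remove u b∈l) ⟩
    + a * (+ b * ∏ (remove b l)) ≡⟨ swap (+ a) (+ b) (∏ (remove b l)) ⟩
    + b * (+ a * ∏ (remove b l)) ≡⟨ cong (λ l′ → + b * ∏ l′) (sym (filter-accept (λ x → ¬? (x ℕ.≟ b)) a≢b)) ⟩
    + b * ∏ (remove b (a ∷ l))   ∎
    where
    open ≡-Reasoning
    swap : ∀ x y z → x * (y * z) ≡ y * (x * z)
    swap = solve-∀
    a≢b : a ≢ b
    a≢b = All.lookup a∉l b∈l

  length-remove : ∀ {l} → Unique l → b ∈ l → length l ≡ suc (length (remove b l))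
  length-remove {b ∷ l} u (here refl) = cong (suc ∘ length) (sym (remove-head u))
  length-remove {a ∷ l} (a∉l ∷ u) (there b∈l) = begin
    suc (length l)                  ≡⟨ cong suc (length-remove u b∈l) ⟩
    suc (suc (length (remove b l))) ≡⟨ cong (suc ∘ length) (sym (filter-accept (λ x → ¬? (x ℕ.≟ b)) (All.lookup a∉l b∈l))) ⟩
    suc (length (remove b (a ∷ l))) ∎
    where open ≡-Reasoning

module PrimeField {p′ : ℕ} (p-prime : Prime (suc p′)) where

  private
    p : ℕ
    p = suc p′

    1<p : 1 < p
    1<p = ℕ.nonTrivial⇒n>1 p {{prime⇒nonTrivial p-prime}}

  IsUnit : ℕ → Set
  IsUnit a = 0 < a × a < p

  Partners : ℤ → ℕ → ℕ → Set
  Partners k a b = + p ∣ + a * + b - k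

  Partners-sym : ∀ {k} a b → Partners k a b → Partners k b a
  Partners-sym {k} a b = ∣-respʳ-≡ (cong (_- k) (ℤₚ.*-comm (+ a) (+ b)))

  partner-unique : ∀ k {a b c} → IsUnit a → b < p → c < p → Partners k a b → Partners k a c → b ≡ c
  partner-unique k {a} {b} {c} (0<a , a<p) b<p c<p ab≡k ac≡k =
    [ (λ p∣a → ⊥-elim (∤-pos-< 0<a a<p p∣a)) , ≡-mod⇒≡ b<p c<p ]′
      (euclidsLemma-ℤ p-prime (+ a) (+ b - + c) (∣-respʳ-≡ (factor (+ a) (+ b) (+ c) k) (∣m∣n⇒∣m-n ab≡k ac≡k)))
    where
    factor : ∀ a b c k → a * b - k - (a * c - k) ≡ a * (b - c)
    factor = solve-∀

  HasPartners : ℤ → List ℕ → Set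
  HasPartners k l = ∀ {a} → a ∈ l → ∃ λ b → b ∈ l × b ≢ a × Partners k a b

  ∏-pairs : ∀ k n l → length l ≤ n → Unique l → (∀ {a} → a ∈ l → IsUnit a) → HasPartners k l →
            Σ ℕ λ e → 2 ℕ.* e ≡ length l × + p ∣ ∏ l - k ^ e
  ∏-pairs k n       []       _ _ _ _ = 0 , refl , ∣x-x (+ p) 1ℤ
  ∏-pairs k (suc n) (a ∷ l) (s≤s |l|≤n) (a∉l ∷ unique) units partners
    with partners (here refl)
  ... | b , here b≡a , b≢a , _ = ⊥-elim (b≢a b≡a)
  ... | b , there b∈l , _ , ab≡k with ∏-pairs k n rest |rest|≤n (remove⁺ unique) rest-units rest-partners
    where
    rest : List ℕ
    rest = remove b l
    |rest|≤n : length rest ≤ n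
    |rest|≤n = ℕₚ.≤-trans (ℕₚ.n≤1+n _) (subst (_≤ n) (length-remove unique b∈l) |l|≤n)
    rest-units : ∀ {c} → c ∈ rest → IsUnit c
    rest-units c∈rest = units (there (proj₁ (∈-remove⁻ c∈rest)))
    rest-partners : HasPartners k rest
    rest-partners {c} c∈rest with ∈-remove⁻ c∈rest
    ... | c∈l , c≢b with partners (there c∈l)
    ...   | d , d∈al , d≢c , cd≡k = d , ∈-remove⁺ (d∈l d∈al) d≢b , d≢c , cd≡k
      where
      d≢a : d ≢ a
      d≢a refl = c≢b (partner-unique k (units (here refl)) (proj₂ (units (there c∈l)))
                                     (proj₂ (units (there b∈l))) (Partners-sym c a cd≡k) ab≡k)
      d≢b : d ≢ b
      d≢b refl = All.lookup a∉l c∈l (sym (partner-unique k (units (there b∈l)) (proj₂ (units (there c∈l)))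
                                     (proj₂ (units (here refl))) (Partners-sym c b cd≡k) (Partners-sym a b ab≡k)))
      d∈l : d ∈ a ∷ l → d ∈ l
      d∈l (here d≡a) = ⊥-elim (d≢a d≡a)
      d∈l (there d∈l) = d∈l
  ... | e , 2e≡|rest| , ∏rest≡kᵉ = suc e , 2[e+1]≡|al| ,
    ∣-respʳ-≡ (sym ∏-step) (∣m∣n⇒∣m+n (∣n⇒∣m*n (+ a * + b) ∏rest≡kᵉ) (∣m⇒∣m*n (k ^ e) ab≡k))
    where
    rest : List ℕ
    rest = remove b l
    2[e+1]≡|al| : 2 ℕ.* suc e ≡ suc (length l)
    2[e+1]≡|al| = trans (ℕₚ.*-suc 2 e) (cong suc (trans (cong suc 2e≡|rest|) (sym (length-remove unique b∈l))))
    ∏-step : ∏ (a ∷ l) - k ^ suc e ≡ + a * + b * (∏ rest - k ^ e) + (+ a * + b - k) * k ^ e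
    ∏-step = trans (cong (λ P → + a * P - k ^ suc e) (∏-remove unique b∈l)) (expand (+ a) (+ b) (∏ rest) (k ^ e) k)
      where
      expand : ∀ a b P K k → a * (b * P) - k * K ≡ a * b * (P - K) + (a * b - k) * K
      expand = solve-∀

  private
    residue-partner : ∀ k a w → + p ∣ + a * w - 1ℤ → Partners k a ((k * w) ℤ.%ℕ p)
    residue-partner k a w aw≡1 = ∣-respʳ-≡ (begin
      k * (+ a * w - 1ℤ) + + p * - (+ a * q)   ≡⟨ regroup k (+ a) w q (+ p) ⟩
      + a * (k * w - q * + p) - k              ≡⟨ cong (λ x → + a * (x - q * + p) - k) (a≡a%ℕn+[a/ℕn]*n (k * w) p) ⟩
      + a * (+ r + q * + p - q * + p) - k      ≡⟨ cancel (+ a) (+ r) (q * + p) k ⟩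
      + a * + r - k                            ∎)
      (∣m∣n⇒∣m+n (∣n⇒∣m*n k aw≡1) (∣m⇒∣m*n _ ∣-refl))
      where
      open ≡-Reasoning
      r : ℕ
      r = (k * w) ℤ.%ℕ p
      q : ℤ
      q = (k * w) ℤ./ℕ p
      regroup : ∀ k a w q p → k * (a * w - 1ℤ) + p * - (a * q) ≡ a * (k * w - q * p) - k
      regroup = solve-∀
      cancel : ∀ a r s k → a * (r + s - s) - k ≡ a * r - k
      cancel = solve-∀

    nonzero-partner : ∀ {k a} b → b < p → ¬ (+ p ∣ k) → Partners k a b → ∃ λ b → IsUnit b × Partners k a b
    nonzero-partner {k} {a} zero    _   p∤k a0≡k = ⊥-elim (p∤k (∣-respʳ-≡ (negate (+ a) k) (∣m⇒∣-m a0≡k)))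
      where
      negate : ∀ a k → - (a * 0ℤ - k) ≡ k
      negate = solve-∀
    nonzero-partner         (suc b) b<p _   ab≡k = suc b , (s≤s z≤n , b<p) , ab≡k

  partner : ∀ k a → IsUnit a → ¬ (+ p ∣ k) → ∃ λ b → IsUnit b × Partners k a b
  partner k a (0<a , a<p) p∤k =
    let w , aw≡1 = inverse p-prime (+ a) (∤-pos-< 0<a a<p)
    in nonzero-partner {k} {a} ((k * w) ℤ.%ℕ p) (n%ℕd<d (k * w) p) p∤k (residue-partner k a w aw≡1)

  units : List ℕ
  units = applyDownFrom suc p′

  units-unique : Unique units
  units-unique = Unique.applyDownFrom⁺₁ suc p′ (λ j<i _ 1+i≡1+j → ℕₚ.<⇒≢ j<i (sym (ℕₚ.suc-injective 1+i≡1+j)))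

  ∈-units⁻ : ∀ {a} → a ∈ units → IsUnit a
  ∈-units⁻ a∈units with ∈-applyDownFrom⁻ suc a∈units
  ... | i , i<p′ , refl = s≤s z≤n , s≤s i<p′

  ∈-units⁺ : ∀ {a} → IsUnit a → a ∈ units
  ∈-units⁺ {suc i} (_ , s≤s i<p′) = ∈-applyDownFrom⁺ suc i<p′

  private
    ∤a-1 : ∀ {a} → IsUnit a → a ≢ 1 → ¬ (+ p ∣ + a - 1ℤ)
    ∤a-1 (_ , a<p) a≢1 p∣a-1 = a≢1 (≡-mod⇒≡ a<p 1<p p∣a-1)

    ∤a+1 : ∀ {a} → IsUnit a → a ≢ p′ → ¬ (+ p ∣ + a + 1ℤ)
    ∤a+1 {a} (_ , s≤s a≤p′) a≢p′ p∣a+1 = ∤-pos-< (s≤s z≤n) (s≤s (ℕₚ.≤∧≢⇒< a≤p′ a≢p′))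
      (∣-respʳ-≡ (trans (sym (ℤₚ.pos-+ a 1)) (cong +_ (ℕₚ.+-comm a 1))) p∣a+1)

    -- Apart from 1 and p′ ≡ -1, every unit differs from its inverse.
    W : List ℕ
    W = remove 1 (remove p′ units)

    W-partner : ∀ {a b} → IsUnit a → a ≢ 1 → a ≢ p′ → IsUnit b → Partners 1ℤ a b → b ∈ W × b ≢ a
    W-partner {a} {b} a-unit a≢1 a≢p′ b-unit ab≡1 =
      ∈-remove⁺ (∈-remove⁺ (∈-units⁺ b-unit) b≢p′) b≢1 , b≢a
      where
      b≢a : b ≢ a
      b≢a refl = [ ∤a-1 a-unit a≢1 , ∤a+1 a-unit a≢p′ ]′
        (euclidsLemma-ℤ p-prime (+ b - 1ℤ) (+ b + 1ℤ) (∣-respʳ-≡ (difference-of-squares (+ b)) ab≡1))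
        where
        difference-of-squares : ∀ b → b * b - 1ℤ ≡ (b - 1ℤ) * (b + 1ℤ)
        difference-of-squares = solve-∀
      b≢1 : b ≢ 1
      b≢1 refl = ∤a-1 a-unit a≢1 (∣-respʳ-≡ (cong (_- 1ℤ) (ℤₚ.*-identityʳ (+ a))) ab≡1)
      b≢p′ : b ≢ p′
      b≢p′ refl = ∤a+1 a-unit a≢p′ (∣-respʳ-≡ (expand (+ a) (+ p′))
        (∣m∣n⇒∣m-n (∣-respʳ-≡ (cong (+ a *_) (sym (ℤₚ.pos-+ 1 p′))) (∣n⇒∣m*n (+ a) ∣-refl)) ab≡1))
        where
        expand : ∀ a q → a * (1ℤ + q) - (a * q - 1ℤ) ≡ a + 1ℤ
        expand = solve-∀

    W-partners : HasPartners 1ℤ W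
    W-partners {a} a∈W =
      let a∈W′ , a≢1    = ∈-remove⁻ a∈W
          a∈units , a≢p′ = ∈-remove⁻ a∈W′
          a-unit         = ∈-units⁻ a∈units
          b , b-unit , ab≡1 = partner 1ℤ a a-unit (∤-pos-< (s≤s z≤n) 1<p)
          b∈W , b≢a      = W-partner a-unit a≢1 a≢p′ b-unit ab≡1
      in b , b∈W , b≢a , ab≡1

  wilson : 1 < p′ → + p ∣ ∏ units + 1ℤ
  wilson 1<p′ =
    let e , _ , ∏W≡1ᵉ = ∏-pairs 1ℤ (length W) W ℕₚ.≤-refl W-unique W-units W-partners
    in ∣-respʳ-≡ (sym ∏units+1) (∣m∣n⇒∣m+n (∣n⇒∣m*n (+ p′) (subst (λ z → + p ∣ ∏ W - z) (ℤₚ.^-zeroˡ e) ∏W≡1ᵉ)) ∣-refl)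
    where
    W-unique : Unique W
    W-unique = remove⁺ (remove⁺ units-unique)
    W-units : ∀ {a} → a ∈ W → IsUnit a
    W-units a∈W = ∈-units⁻ (proj₁ (∈-remove⁻ (proj₁ (∈-remove⁻ a∈W))))
    p′∈units : p′ ∈ units
    p′∈units = ∈-units⁺ (ℕₚ.<-trans (s≤s z≤n) 1<p′ , ℕₚ.≤-refl)
    1∈units∖p′ : 1 ∈ remove p′ units
    1∈units∖p′ = ∈-remove⁺ (∈-units⁺ (s≤s z≤n , 1<p)) (ℕₚ.<⇒≢ 1<p′)
    ∏units+1 : ∏ units + 1ℤ ≡ + p′ * (∏ W - 1ℤ) + + p
    ∏units+1 = begin
      ∏ units + 1ℤ                          ≡⟨ cong (_+ 1ℤ) (∏-remove units-unique p′∈units) ⟩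
      + p′ * ∏ (remove p′ units) + 1ℤ       ≡⟨ cong (λ z → + p′ * z + 1ℤ) (∏-remove (remove⁺ units-unique) 1∈units∖p′) ⟩
      + p′ * (1ℤ * ∏ W) + 1ℤ                ≡⟨ regroup (+ p′) (∏ W) ⟩
      + p′ * (∏ W - 1ℤ) + (1ℤ + + p′)       ∎
      where
      open ≡-Reasoning
      regroup : ∀ q X → q * (1ℤ * X) + 1ℤ ≡ q * (X - 1ℤ) + (1ℤ + q)
      regroup = solve-∀

  module _ (2<p : 2 < p) (nonresidue : ∀ {a} → IsUnit a → ¬ Partners (+ 2) a a) where

    units-partners : HasPartners (+ 2) units
    units-partners {a} a∈units = in-units (partner (+ 2) a (∈-units⁻ a∈units) (∤-pos-< (s≤s z≤n) 2<p))
      where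
      in-units : (∃ λ b → IsUnit b × Partners (+ 2) a b) → ∃ λ b → b ∈ units × b ≢ a × Partners (+ 2) a b
      in-units (b , b-unit , ab≡2) = b , ∈-units⁺ b-unit , b≢a , ab≡2
        where
        b≢a : b ≢ a
        b≢a refl = nonresidue b-unit ab≡2

    ∏units≡2ᵉ : Σ ℕ λ e → 2 ℕ.* e ≡ p′ × + p ∣ ∏ units - (+ 2) ^ e
    ∏units≡2ᵉ = map₂ (map₁ (λ 2e≡|units| → trans 2e≡|units| (length-applyDownFrom suc p′)))
      (∏-pairs (+ 2) (length units) units ℕₚ.≤-refl units-unique ∈-units⁻ units-partners)

-- Gauss's lemma for 2

prod : (ℕ → ℤ) → ℕ → ℤ
prod f zero    = 1ℤ
prod f (suc n) = prod f n * f (suc n)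

prod-cong : ∀ {f g} n → (∀ {j} → 1 ≤ j → j ≤ n → f j ≡ g j) → prod f n ≡ prod g n
prod-cong zero    f≡g = refl
prod-cong (suc n) f≡g = cong₂ _*_ (prod-cong n (λ 1≤j j≤n → f≡g 1≤j (ℕₚ.m≤n⇒m≤1+n j≤n))) (f≡g (s≤s z≤n) ℕₚ.≤-refl)

prod-congᵐ : ∀ {P f g} → (∀ j → P ∣ f j - g j) → ∀ n → P ∣ prod f n - prod g n
prod-congᵐ {P} f≡g zero    = ∣x-x P 1ℤ
prod-congᵐ {P} {f} {g} f≡g (suc n) = ∣-respʳ-≡ (sym (regroup (prod f n) (prod g n) (f (suc n)) (g (suc n))))
  (∣m∣n⇒∣m+n (∣n⇒∣m*n (prod f n) (f≡g (suc n))) (∣m⇒∣m*n (g (suc n)) (prod-congᵐ f≡g n)))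
  where
  regroup : ∀ A B a b → A * a - B * b ≡ A * (a - b) + (A - B) * b
  regroup = solve-∀

prod-+ : ∀ f u v → prod f (u ℕ.+ v) ≡ prod f u * prod (λ j → f (u ℕ.+ j)) v
prod-+ f u zero    = trans (cong (prod f) (ℕₚ.+-identityʳ u)) (sym (ℤₚ.*-identityʳ (prod f u)))
prod-+ f u (suc v) = begin
  prod f (u ℕ.+ suc v)                                        ≡⟨ cong (prod f) (ℕₚ.+-suc u v) ⟩
  prod f (u ℕ.+ v) * f (suc (u ℕ.+ v))                         ≡⟨ cong (_* f (suc (u ℕ.+ v))) (prod-+ f u v) ⟩
  prod f u * prod (λ j → f (u ℕ.+ j)) v * f (suc (u ℕ.+ v))    ≡⟨ ℤₚ.*-assoc (prod f u) _ _ ⟩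
  prod f u * (prod (λ j → f (u ℕ.+ j)) v * f (suc (u ℕ.+ v)))
    ≡⟨ cong (λ k → prod f u * (prod (λ j → f (u ℕ.+ j)) v * f k)) (sym (ℕₚ.+-suc u v)) ⟩
  prod f u * prod (λ j → f (u ℕ.+ j)) (suc v)                 ∎
  where open ≡-Reasoning

prod-shift : ∀ f n → prod f (suc n) ≡ f 1 * prod (λ j → f (suc j)) n
prod-shift f zero    = trans (ℤₚ.*-identityˡ (f 1)) (sym (ℤₚ.*-identityʳ (f 1)))
prod-shift f (suc n) = trans (cong (_* f (suc (suc n))) (prod-shift f n)) (ℤₚ.*-assoc (f 1) _ _)

prod-reverse : ∀ f n → prod f n ≡ prod (λ j → f (suc n ℕ.∸ j)) n
prod-reverse f zero    = refl
prod-reverse f (suc n) = begin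
  prod f n * f (suc n)                                ≡⟨ cong (_* f (suc n)) (prod-reverse f n) ⟩
  prod (λ j → f (suc n ℕ.∸ j)) n * f (suc n)          ≡⟨ ℤₚ.*-comm _ (f (suc n)) ⟩
  f (suc n) * prod (λ j → f (suc n ℕ.∸ j)) n          ≡⟨ sym (prod-shift (λ j → f (suc (suc n) ℕ.∸ j)) n) ⟩
  prod (λ j → f (suc (suc n) ℕ.∸ j)) (suc n)          ∎
  where open ≡-Reasoning

prod-neg : ∀ f n → prod (λ j → - f j) n ≡ (- 1ℤ) ^ n * prod f n
prod-neg f zero    = refl
prod-neg f (suc n) = trans (cong (_* - f (suc n)) (prod-neg f n)) (regroup ((- 1ℤ) ^ n) (prod f n) (f (suc n)))
  where
  regroup : ∀ S P x → S * P * - x ≡ - 1ℤ * S * (P * x)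
  regroup = solve-∀

factorial : ℕ → ℤ
factorial = prod (λ j → + j)

even odd : ℕ → ℤ
even j = (+ 2) * + j
odd  j = (+ 2) * + j - 1ℤ

prod-even : ∀ n → prod even n ≡ (+ 2) ^ n * factorial n
prod-even zero    = refl
prod-even (suc n) = trans (cong (_* even (suc n)) (prod-even n)) (regroup ((+ 2) ^ n) (factorial n) (+ suc n))
  where
  regroup : ∀ T P j → T * P * ((+ 2) * j) ≡ (+ 2) * T * (P * j)
  regroup = solve-∀

private
  2[1+n]≡2+2n : ∀ n → 2 ℕ.* suc n ≡ suc (suc (2 ℕ.* n))
  2[1+n]≡2+2n = ℕ-Solver.solve-∀

  even-suc : ∀ n → even (suc n) ≡ + suc (suc (2 ℕ.* n))
  even-suc n = trans (sym (ℤₚ.pos-* 2 (suc n))) (cong +_ (2[1+n]≡2+2n n))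

  odd-suc : ∀ n → odd (suc n) ≡ + suc (2 ℕ.* n)
  odd-suc n = trans (cong (_- 1ℤ) (even-suc n)) (cancel (+ suc (2 ℕ.* n)))
    where
    cancel : ∀ x → 1ℤ + x - 1ℤ ≡ x
    cancel = solve-∀

prod-even*odd : ∀ n → prod even n * prod odd n ≡ factorial (2 ℕ.* n)
prod-even*odd zero    = refl
prod-even*odd (suc n) = begin
  prod even n * even (suc n) * (prod odd n * odd (suc n))
    ≡⟨ regroup (prod even n) (prod odd n) (even (suc n)) (odd (suc n)) ⟩
  prod even n * prod odd n * odd (suc n) * even (suc n)
    ≡⟨ cong₂ (λ P o → P * o * even (suc n)) (prod-even*odd n) (odd-suc n) ⟩
  factorial (2 ℕ.* n) * + suc (2 ℕ.* n) * even (suc n)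
    ≡⟨ cong (factorial (2 ℕ.* n) * + suc (2 ℕ.* n) *_) (even-suc n) ⟩
  factorial (suc (suc (2 ℕ.* n)))
    ≡⟨ cong (factorial) (sym (2[1+n]≡2+2n n)) ⟩
  factorial (2 ℕ.* suc n) ∎
  where
  open ≡-Reasoning
  regroup : ∀ E O e o → E * e * (O * o) ≡ E * O * o * e
  regroup = solve-∀

prod-even*odd′ : ∀ n → prod even n * prod odd (suc n) ≡ factorial (suc (2 ℕ.* n))
prod-even*odd′ n = trans (sym (ℤₚ.*-assoc (prod even n) (prod odd n) (odd (suc n))))
                         (cong₂ _*_ (prod-even*odd n) (odd-suc n))

-- With p = 2(u + v) + 1, the evens 2j with u < j ≤ u + v exceed p/2 and are ≡ -(p - 2j), the odd numbers
-- below p/2 in reverse order; v is even, so the signs cancel.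
evens≡evens*odds : ∀ {p′} u v w → p′ ≡ 2 ℕ.* (u ℕ.+ v) → v ≡ 2 ℕ.* w →
                   + suc p′ ∣ prod even (u ℕ.+ v) - prod even u * prod odd v
evens≡evens*odds {p′} u v w p′≡2[u+v] v≡2w =
  ∣-respʳ-≡ (trans (factor (prod even u) _ (prod odd v)) (cong (_- prod even u * prod odd v) (sym (prod-+ even u v))))
    (∣n⇒∣m*n (prod even u) upper-evens≡odds)
  where
  P : ℤ
  P = + suc p′
  factor : ∀ E X O → E * (X - O) ≡ E * X - E * O
  factor = solve-∀

  upper-even≡-odd : ∀ {j} → 1 ≤ j → j ≤ v → even (u ℕ.+ j) - P ≡ - odd (suc v ℕ.∸ j)
  upper-even≡-odd {j} _ j≤v = begin
    even (u ℕ.+ j) - P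
      ≡⟨ cong₂ _-_ (sym (ℤₚ.pos-* 2 (u ℕ.+ j)))
                   (cong (+_ ∘ suc) (trans p′≡2[u+v] (cong (λ z → 2 ℕ.* (u ℕ.+ z)) (sym (ℕₚ.m+[n∸m]≡n j≤v))))) ⟩
    + (2 ℕ.* (u ℕ.+ j)) - + suc (2 ℕ.* (u ℕ.+ (j ℕ.+ (v ℕ.∸ j))))
      ≡⟨ cong (λ z → + (2 ℕ.* (u ℕ.+ j)) - + z) (split u j (v ℕ.∸ j)) ⟩
    + (2 ℕ.* (u ℕ.+ j)) - + (2 ℕ.* (u ℕ.+ j) ℕ.+ suc (2 ℕ.* (v ℕ.∸ j)))
      ≡⟨ difference (2 ℕ.* (u ℕ.+ j)) (suc (2 ℕ.* (v ℕ.∸ j))) ⟩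
    - + suc (2 ℕ.* (v ℕ.∸ j))
      ≡⟨ cong -_ (sym (trans (cong odd (ℕₚ.+-∸-assoc 1 j≤v)) (odd-suc (v ℕ.∸ j)))) ⟩
    - odd (suc v ℕ.∸ j) ∎
    where
    open ≡-Reasoning
    split : ∀ u j d → suc (2 ℕ.* (u ℕ.+ (j ℕ.+ d))) ≡ 2 ℕ.* (u ℕ.+ j) ℕ.+ suc (2 ℕ.* d)
    split = ℕ-Solver.solve-∀
    difference : ∀ a b → + a - + (a ℕ.+ b) ≡ - + b
    difference a b = trans (cong (λ z → + a - z) (ℤₚ.pos-+ a b)) (cancel (+ a) (+ b))
      where
      cancel : ∀ a b → a - (a + b) ≡ - b
      cancel = solve-∀

  upper-evens≡odds : P ∣ prod (λ j → even (u ℕ.+ j)) v - prod odd v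
  upper-evens≡odds = ∣-respʳ-≡ (cong (λ z → prod (λ j → even (u ℕ.+ j)) v - z) (begin
    prod (λ j → even (u ℕ.+ j) - P) v         ≡⟨ prod-cong v upper-even≡-odd ⟩
    prod (λ j → - odd (suc v ℕ.∸ j)) v        ≡⟨ sym (prod-reverse (λ j → - odd j) v) ⟩
    prod (λ j → - odd j) v                    ≡⟨ prod-neg odd v ⟩
    (- 1ℤ) ^ v * prod odd v                   ≡⟨ cong (λ k → (- 1ℤ) ^ k * prod odd v) v≡2w ⟩
    (- 1ℤ) ^ (2 ℕ.* w) * prod odd v
      ≡⟨ cong (_* prod odd v) (trans (sym (ℤₚ.^-*-assoc (- 1ℤ) 2 w)) (ℤₚ.^-zeroˡ w)) ⟩
    1ℤ * prod odd v                           ≡⟨ ℤₚ.*-identityˡ (prod odd v) ⟩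
    prod odd v                                ∎))
    (prod-congᵐ (λ j → ∣-respʳ-≡ (sym (cancel (even (u ℕ.+ j)) P)) ∣-refl) v)
    where
    open ≡-Reasoning
    cancel : ∀ a P → a - (a - P) ≡ P
    cancel = solve-∀

private
  2^h*h!≡h! : ∀ {p′} u v w → p′ ≡ 2 ℕ.* (u ℕ.+ v) → v ≡ 2 ℕ.* w → prod even u * prod odd v ≡ factorial (u ℕ.+ v) →
              + suc p′ ∣ (+ 2) ^ (u ℕ.+ v) * factorial (u ℕ.+ v) - factorial (u ℕ.+ v)
  2^h*h!≡h! u v w p′≡2[u+v] v≡2w evens*odds≡h! =
    ∣-respʳ-≡ (cong₂ _-_ (prod-even (u ℕ.+ v)) evens*odds≡h!) (evens≡evens*odds u v w p′≡2[u+v] v≡2w)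

±1-mod-8⇒2^h≡1 : ∀ p′ → ±1-mod-8 (suc p′) →
                 Σ ℕ λ h → p′ ≡ 2 ℕ.* h × + suc p′ ∣ (+ 2) ^ h * factorial h - factorial h
±1-mod-8⇒2^h≡1 p′ (inj₁ p≡1) = 2 ℕ.* t ℕ.+ 2 ℕ.* t , trans p′≡8t (8t≡2[2t+2t] t) ,
  2^h*h!≡h! (2 ℕ.* t) (2 ℕ.* t) t (trans p′≡8t (8t≡2[2t+2t] t)) refl
    (trans (prod-even*odd (2 ℕ.* t)) (cong factorial (2[2t]≡2t+2t t)))
  where
  t : ℕ
  t = suc p′ ℕ./ 8
  p′≡8t : p′ ≡ t ℕ.* 8
  p′≡8t = ℕₚ.suc-injective (trans (m≡m%n+[m/n]*n (suc p′) 8) (cong (ℕ._+ t ℕ.* 8) p≡1))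
  8t≡2[2t+2t] : ∀ t → t ℕ.* 8 ≡ 2 ℕ.* (2 ℕ.* t ℕ.+ 2 ℕ.* t)
  8t≡2[2t+2t] = ℕ-Solver.solve-∀
  2[2t]≡2t+2t : ∀ t → 2 ℕ.* (2 ℕ.* t) ≡ 2 ℕ.* t ℕ.+ 2 ℕ.* t
  2[2t]≡2t+2t = ℕ-Solver.solve-∀
±1-mod-8⇒2^h≡1 p′ (inj₂ p≡7) = u ℕ.+ suc u , trans p′≡8t+6 (8t+6≡2[u+u+1] t) ,
  2^h*h!≡h! u (suc u) (suc t) (trans p′≡8t+6 (8t+6≡2[u+u+1] t)) (2t+2≡2[t+1] t)
    (trans (prod-even*odd′ u) (cong factorial (1+2u≡u+1+u u)))
  where
  t : ℕ
  t = suc p′ ℕ./ 8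
  u : ℕ
  u = suc (2 ℕ.* t)
  p′≡8t+6 : p′ ≡ 6 ℕ.+ t ℕ.* 8
  p′≡8t+6 = ℕₚ.suc-injective (trans (m≡m%n+[m/n]*n (suc p′) 8) (cong (ℕ._+ t ℕ.* 8) p≡7))
  8t+6≡2[u+u+1] : ∀ t → 6 ℕ.+ t ℕ.* 8 ≡ 2 ℕ.* (suc (2 ℕ.* t) ℕ.+ suc (suc (2 ℕ.* t)))
  8t+6≡2[u+u+1] = ℕ-Solver.solve-∀
  2t+2≡2[t+1] : ∀ t → suc (suc (2 ℕ.* t)) ≡ 2 ℕ.* suc t
  2t+2≡2[t+1] = ℕ-Solver.solve-∀
  1+2u≡u+1+u : ∀ u → suc (2 ℕ.* u) ≡ u ℕ.+ suc u
  1+2u≡u+1+u = ℕ-Solver.solve-∀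

prime∤factorial : ∀ {p} → Prime p → ∀ n → n < p → ¬ (+ p ∣ factorial n)
prime∤factorial p-prime zero    _   = ∤-pos-< (s≤s z≤n) (ℕ.nonTrivial⇒n>1 _ {{prime⇒nonTrivial p-prime}})
prime∤factorial p-prime (suc n) n<p = ∤-* p-prime (prime∤factorial p-prime n (ℕₚ.<-trans (ℕₚ.n<1+n n) n<p))
                                              (∤-pos-< (s≤s z≤n) n<p)

±1-mod-8⇒two-square : ∀ {p} → Prime p → 2 < p → ±1-mod-8 p → TwoIsSquareMod p
±1-mod-8⇒two-square {suc p′} p-prime 2<p p≡±1 with any? (λ a → + suc p′ ∣? + a * + a - + 2) (PrimeField.units p-prime)
... | yes found = let a , a²≡2 = satisfied found in + a , a²≡2
... | no  none  = ⊥-elim (∤-pos-< (s≤s z≤n) 2<p p∣2)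
  where
  open PrimeField p-prime
  P : ℤ
  P = + suc p′
  euler : Σ ℕ λ e → 2 ℕ.* e ≡ p′ × P ∣ ∏ units - (+ 2) ^ e
  euler = ∏units≡2ᵉ 2<p (λ a-unit a²≡2 → none (lose (∈-units⁺ a-unit) a²≡2))
  gauss : Σ ℕ λ h → p′ ≡ 2 ℕ.* h × P ∣ (+ 2) ^ h * factorial h - factorial h
  gauss = ±1-mod-8⇒2^h≡1 p′ p≡±1
  h : ℕ
  h = proj₁ gauss
  e≡h : proj₁ euler ≡ h
  e≡h = ℕₚ.*-cancelˡ-≡ (proj₁ euler) h 2 (trans (proj₁ (proj₂ euler)) (proj₁ (proj₂ gauss)))
  ∏≡2^h : P ∣ ∏ units - (+ 2) ^ h
  ∏≡2^h = subst (λ e → P ∣ ∏ units - (+ 2) ^ e) e≡h (proj₂ (proj₂ euler))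
  2^h≡-1 : P ∣ (+ 2) ^ h + 1ℤ
  2^h≡-1 = ∣-respʳ-≡ (cancel (∏ units) ((+ 2) ^ h)) (∣m∣n⇒∣m-n (wilson (ℕₚ.≤-pred 2<p)) ∏≡2^h)
    where
    cancel : ∀ X T → X + 1ℤ - (X - T) ≡ T + 1ℤ
    cancel = solve-∀
  h<p : h < suc p′
  h<p = s≤s (subst (h ℕ.≤_) (sym (proj₁ (proj₂ gauss))) (ℕₚ.m≤n*m h 2))
  2^h≡1 : P ∣ (+ 2) ^ h - 1ℤ
  2^h≡1 = [ (λ p∣2^h-1 → p∣2^h-1) , (λ p∣h! → ⊥-elim (prime∤factorial p-prime h h<p p∣h!)) ]′
    (euclidsLemma-ℤ p-prime ((+ 2) ^ h - 1ℤ) (factorial h)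
      (∣-respʳ-≡ (factor ((+ 2) ^ h) (factorial h)) (proj₂ (proj₂ gauss))))
    where
    factor : ∀ T F → T * F - F ≡ (T - 1ℤ) * F
    factor = solve-∀
  p∣2 : P ∣ + 2
  p∣2 = ∣-respʳ-≡ (cancel ((+ 2) ^ h)) (∣m∣n⇒∣m-n 2^h≡-1 2^h≡1)
    where
    cancel : ∀ T → T + 1ℤ - (T - 1ℤ) ≡ + 2
    cancel = solve-∀

private
  ±1-mod-8? : ∀ n → Dec (±1-mod-8 n)
  ±1-mod-8? n = (n ℕ.% 8 ℕ.≟ 1) ⊎-dec (n ℕ.% 8 ℕ.≟ 7)

  ShiftBy2 : ℕ → Set
  ShiftBy2 r = (±1-mod-8 (r ℕ.+ 2) → r ≡ 5 ⊎ r ≡ 7) × (r ≡ 5 ⊎ r ≡ 7 → ±1-mod-8 (r ℕ.+ 2))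

  shiftBy2-table : All ShiftBy2 (upTo 8)
  shiftBy2-table = toWitness {a? = all? (λ r → (±1-mod-8? (r ℕ.+ 2) →-dec ((r ℕ.≟ 5) ⊎-dec (r ℕ.≟ 7)))
                                           ×-dec (((r ℕ.≟ 5) ⊎-dec (r ℕ.≟ 7)) →-dec ±1-mod-8? (r ℕ.+ 2)))
                                     (upTo 8)} _

±1-mod-8-+2 : ∀ p → ±1-mod-8 (p ℕ.+ 2) ⇔ (p ℕ.% 8 ≡ 5 ⊎ p ℕ.% 8 ≡ 7)
±1-mod-8-+2 p = mk⇔ (λ q≡±1 → proj₁ entry (subst (λ r → r ≡ 1 ⊎ r ≡ 7) [p+2]%8 q≡±1))
                    (λ p≡5,7 → subst (λ r → r ≡ 1 ⊎ r ≡ 7) (sym [p+2]%8) (proj₂ entry p≡5,7))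
  where
  entry : ShiftBy2 (p ℕ.% 8)
  entry = All.lookup shiftBy2-table (∈-upTo⁺ (m%n<n p 8))
  [p+2]%8 : (p ℕ.+ 2) ℕ.% 8 ≡ (p ℕ.% 8 ℕ.+ 2) ℕ.% 8
  [p+2]%8 = %-distribˡ-+ p 2 8

legendre⇔two-square : ∀ p → LegendreTwoIsOne p ⇔ TwoIsSquareMod p
legendre⇔two-square p =
  mk⇔ (λ (x , p∣x^2-2) → x , ∣-respʳ-≡ (cong (_- + 2) (x^2≡x*x x)) (∣ᵤ⇒∣ p∣x^2-2))
      (λ (x , p∣x²-2) → x , ∣⇒∣ᵤ (∣-respʳ-≡ (cong (_- + 2) (sym (x^2≡x*x x))) p∣x²-2))

odd-prime : ∀ {p} → Prime p → p ≢ 2 → Odd p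
odd-prime {p} p-prime p≢2 = [ (λ p%2≡0 → ⊥-elim (even-impossible (prime⇒irreducible p-prime (ℕᵈ.m%n≡0⇒n∣m p 2 p%2≡0))))
                            , id ]′ (%2≡0⊎%2≡1 p)
  where
  even-impossible : 2 ≡ 1 ⊎ 2 ≡ p → ⊥
  even-impossible (inj₁ ())
  even-impossible (inj₂ 2≡p) = p≢2 (sym 2≡p)

local-conditions : ∀ {ℓ c} τ σ → Prime ℓ → 2 < ℓ → τ * τ ≡ 1ℤ → σ * σ ≡ 1ℤ →
  c ≡ (+ 2) * τ + (+ 2) * σ * + ℓ →
  (HasQvPoint ℓ c ⇔ LegendreTwoIsOne ℓ) × (LegendreTwoIsOne ℓ ⇔ ±1-mod-8 ℓ)
local-conditions {ℓ} τ σ ℓ-prime 2<ℓ τ²≡1 σ²≡1 refl =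
  mk⇔ (λ point → from (OddPrime.point⇒two-square ℓ-prime ℓ∤2 {τ} {σ} τ²≡1 σ²≡1 point))
      (λ legendre → two-square⇒point ((+ 2) * τ + (+ 2) * σ * + ℓ) ℓ-prime ℓ∤2 (to legendre)) ,
  mk⇔ (λ legendre → two-square⇒±1-mod-8 ℓ (odd-prime ℓ-prime ℓ≢2) (to legendre))
      (λ ℓ≡±1 → from (±1-mod-8⇒two-square ℓ-prime 2<ℓ ℓ≡±1))
  where
  open Equivalence (legendre⇔two-square ℓ)
  ℓ∤2 : ¬ (+ ℓ ∣ + 2)
  ℓ∤2 = ∤-pos-< (s≤s z≤n) 2<ℓ
  ℓ≢2 : ℓ ≢ 2
  ℓ≢2 ℓ≡2 = ℕₚ.<⇒≢ 2<ℓ (sym ℓ≡2)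

sign²≡1 : ∀ {σ} → σ ≡ + 1 ⊎ σ ≡ - (+ 1) → σ * σ ≡ 1ℤ
sign²≡1 (inj₁ refl) = refl
sign²≡1 (inj₂ refl) = refl

twin-prime>2 : ∀ {p} → Prime p → Prime (p ℕ.+ 2) → 2 < p
twin-prime>2 {p} p-prime q-prime = ℕₚ.≤∧≢⇒< (ℕ.nonTrivial⇒n>1 p {{prime⇒nonTrivial p-prime}})
                                             (λ { refl → composite⇒¬prime composite[4] q-prime })

module _ (p : ℕ) (σ : ℤ) where

  private
    σ[p+q]≡σ[P+P+2] : σ * + (p ℕ.+ (p ℕ.+ 2)) ≡ σ * (+ p + (+ p + + 2))
    σ[p+q]≡σ[P+P+2] = cong (σ *_) (trans (ℤₚ.pos-+ p (p ℕ.+ 2)) (cong (λ z → + p + z) (ℤₚ.pos-+ p 2)))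

  σ[p+q]≡2σ+2σp : σ * + (p ℕ.+ (p ℕ.+ 2)) ≡ (+ 2) * σ + (+ 2) * σ * + p
  σ[p+q]≡2σ+2σp = trans σ[p+q]≡σ[P+P+2] (regroup σ (+ p))
    where
    regroup : ∀ σ P → σ * (P + (P + + 2)) ≡ (+ 2) * σ + (+ 2) * σ * P
    regroup = solve-∀

  σ[p+q]≡-2σ+2σq : σ * + (p ℕ.+ (p ℕ.+ 2)) ≡ (+ 2) * - σ + (+ 2) * σ * + (p ℕ.+ 2)
  σ[p+q]≡-2σ+2σq = trans σ[p+q]≡σ[P+P+2]
    (trans (regroup σ (+ p)) (cong (λ Q → (+ 2) * - σ + (+ 2) * σ * Q) (sym (ℤₚ.pos-+ p 2))))
    where
    regroup : ∀ σ P → σ * (P + (P + + 2)) ≡ (+ 2) * - σ + (+ 2) * σ * (P + + 2)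
    regroup = solve-∀

  point-at-2 : p ℕ.% 8 ≡ 7 → HasQvPoint 2 (σ * + (p ℕ.+ (p ℕ.+ 2)))
  point-at-2 p%8≡7 = subst (HasQvPoint 2) (sym c≡16r) (dyadic-point (σ * + suc t))
    where
    t : ℕ
    t = p ℕ./ 8
    p≡7+8t : p ≡ 7 ℕ.+ t ℕ.* 8
    p≡7+8t = trans (m≡m%n+[m/n]*n p 8) (cong (ℕ._+ t ℕ.* 8) p%8≡7)
    p+q≡16[t+1] : ∀ t → 7 ℕ.+ t ℕ.* 8 ℕ.+ (7 ℕ.+ t ℕ.* 8 ℕ.+ 2) ≡ 16 ℕ.* suc t
    p+q≡16[t+1] = ℕ-Solver.solve-∀
    regroup : ∀ σ T → σ * ((+ 16) * T) ≡ (+ 16) * (σ * T)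
    regroup = solve-∀
    c≡16r : σ * + (p ℕ.+ (p ℕ.+ 2)) ≡ (+ 16) * (σ * + suc t)
    c≡16r = trans (cong (λ n → σ * + n) (trans (cong (λ x → x ℕ.+ (x ℕ.+ 2)) p≡7+8t) (p+q≡16[t+1] t)))
                  (trans (cong (σ *_) (ℤₚ.pos-* 16 (suc t))) (regroup σ (+ suc t)))

proposition3p5 : (p q : ℕ) → Prime p → Prime q → q ≡ p ℕ.+ 2 →
    (σ : ℤ) → (σ ≡ + 1 ⊎ σ ≡ - (+ 1)) →
      (p ℕ.% 8 ≡ 7 → HasQvPoint 2 (σ * + (p ℕ.+ q)))
      × ((HasQvPoint p (σ * + (p ℕ.+ q)) ⇔ LegendreTwoIsOne p)
         × (LegendreTwoIsOne p ⇔ (p ℕ.% 8 ≡ 1 ⊎ p ℕ.% 8 ≡ 7)))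
      × ((HasQvPoint q (σ * + (p ℕ.+ q)) ⇔ LegendreTwoIsOne q)
         × (LegendreTwoIsOne q ⇔ (q ℕ.% 8 ≡ 1 ⊎ q ℕ.% 8 ≡ 7))
         × ((q ℕ.% 8 ≡ 1 ⊎ q ℕ.% 8 ≡ 7) ⇔ (p ℕ.% 8 ≡ 5 ⊎ p ℕ.% 8 ≡ 7)))
proposition3p5 p .(p ℕ.+ 2) p-prime q-prime refl σ σ≡±1 =
  let q-points , q-legendre = local-conditions (- σ) σ q-prime 2<q -σ²≡1 σ²≡1 (σ[p+q]≡-2σ+2σq p σ)
  in point-at-2 p σ ,
     local-conditions σ σ p-prime 2<p σ²≡1 σ²≡1 (σ[p+q]≡2σ+2σp p σ) ,
     q-points , q-legendre , ±1-mod-8-+2 p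
  where
  σ²≡1 : σ * σ ≡ 1ℤ
  σ²≡1 = sign²≡1 σ≡±1
  -σ²≡1 : - σ * - σ ≡ 1ℤ
  -σ²≡1 = trans (negate σ) σ²≡1
    where
    negate : ∀ σ → - σ * - σ ≡ σ * σ
    negate = solve-∀
  2<p : 2 < p
  2<p = twin-prime>2 p-prime q-prime
  2<q : 2 < p ℕ.+ 2
  2<q = ℕₚ.<-≤-trans 2<p (ℕₚ.m≤m+n p 2)
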